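{- Let $k\ge1$ and let $\mathcal{M}$ be a gridding matrix such that (1) $\mathcal{M}$ has no completely empty rows or columns; (2) every row and every column of $\mathcal{M}$ contains at most two non-empty cells; and (3) the graph $G_\mathcal{M}$ is a path of length $k$ (with $k$ edges) whose internal vertices are each labelled by $\mathrm{Av}(21)$ or $\mathrm{Av}(12)$ and whose two end vertices are each labelled by either $\oplus21$ or $\ominus12$. Then $\mathcal{M}$ and $\mathcal{M}^k$ are equivalent under some grid mapping.
   Context: Matrices are indexed from the bottom-left with column index first: an $m\times n$ matrix has $m$ columns and $n$ rows, $\mathcal{M}_{ij}$ in column $i$, row $j$. A gridding matrix has entries that are permutation classes (infinite or empty, $\varnothing$). $\mathrm{Av}(21)$, $\mathrm{Av}(12)$ are the increasing and decreasing permutations. $\oplus21$ is the class of all direct sums $\alpha_1\oplus\cdots\oplus\alpha_r$ with each $\alpha_i\le21$, and $\ominus12$ the class of all skew sums $\alpha_1\ominus\cdots\ominus\alpha_r$ with each $\alpha_i\le12$. $G_\mathcal{M}$ is the graph on the non-empty cells in which two cells are adjacent if they share a row or column and all cells strictly between them are empty. Grid mappings: grid inverse $\phi$ with $(\phi(\mathcal{M}))_{ij}=(\mathcal{M}_{ji})^{ -1}$ (classes of inverses); $i$th column reverse replacing each entry in column $i$ by its reverse class; $j$th row complement replacing each entry in row $j$ by its complement class; column permutation $\mu$: $(\mu(\mathcal{M}))_{ij}=\mathcal{M}_{\mu(i)j}$; row permutation $\nu$: $(\nu(\mathcal{M}))_{ij}=\mathcal{M}_{i\nu(j)}$; a grid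 mapping is any composition of these. $\mathcal{M}$ and $\mathcal{N}$ are equivalent under a grid mapping if $f(\mathcal{M})=\mathcal{N}$ for some grid mapping $f$. The matrices $\mathcal{M}^k$: let $\mathcal{C}=\mathcal{D}^+=\oplus21$ and $\mathcal{D}^-=\ominus12$. $\mathcal{M}^1$ is the $2\times1$ matrix with $\mathcal{M}^1_{11}=\mathcal{C}$, $\mathcal{M}^1_{21}=\mathcal{D}^-$. For $k\ge2$, with $\ell\ge0$: if $k=4\ell+1$, $\mathcal{M}^k$ is $(2\ell+2)\times(2\ell+1)$ with $\mathcal{M}^k_{ij}=\mathcal{M}^{k-1}_{ij}$ for $i\in[1,2\ell+1],j\in[2,2\ell+1]$, $\mathcal{M}^k_{(2\ell+2)1}=\mathcal{D}^-$, $\mathcal{M}^k_{11}=\mathrm{Av}(21)$, all other entries $\varnothing$; if $k=4\ell+2$, $\mathcal{M}^k$ is $(2\ell+2)\times(2\ell+2)$ with $\mathcal{M}^k_{ij}=\mathcal{M}^{k-1}_{ij}$ for $i,j\in[1,2\ell+1]$, $\mathcal{M}^k_{(2\ell+2)(2\ell+2)}=\mathcal{D}^+$, $\mathcal{M}^k_{(2\ell+2)1}=\mathrm{Av}(12)$, others $\varnothing$; if $k=4\ell+3$, $\mathcal{M}^k$ is $(2\ell+3)\times(2\ell+2)$ with $\mathcal{M}^k_{ij}=\mathcal{M}^{k-1}_{(i-1)j}$ for $i\in[2,2\ell+3],j\in[1,2\ell+1]$, $\mathcal{M}^k_{1(2\ell+2)}=\mathcal{D}^-$, $\mathcal{M}^k_{(2\ell+3)(2\ell+2)}=\mathrm{Av}(21)$,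 others $\varnothing$; if $k=4\ell+4$, $\mathcal{M}^k$ is $(2\ell+3)\times(2\ell+3)$ with $\mathcal{M}^k_{ij}=\mathcal{M}^{k-1}_{i(j-1)}$ for $i\in[1,2\ell+2],j\in[2,2\ell+3]$, $\mathcal{M}^k_{11}=\mathcal{D}^+$, $\mathcal{M}^k_{1(2\ell+3)}=\mathrm{Av}(12)$, others $\varnothing$. -}

module Defs where

open import Data.Nat.Base using (ℕ; zero; suc; _+_; _*_; _∸_; _≤ᵇ_; _≡ᵇ_)
open import Data.Bool.Base using (Bool; true; false; if_then_else_; _∧_)
open import Data.Fin.Base using (Fin; toℕ; _<_)
open import Data.Fin.Permutation using (Permutation′; _⟨$⟩ʳ_)
open import Data.Product using (Σ; _×_; _,_; ∃; proj₁; proj₂)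
open import Data.Sum using (_⊎_)
open import Relation.Binary.PropositionalEquality using (_≡_; _≢_)
open import Function.Definitions using (Injective)
open import Data.Empty using (⊥)

data Label : Set where
  ∅     : Label
  av21  : Label
  av12  : Label
  ⊕21   : Label   -- direct sums of permutations ≤ 21
  ⊖12   : Label   -- skew sums of permutations ≤ 12

rev : Label → Label
rev ∅    = ∅
rev av21 = av12
rev av12 = av21
rev ⊕21  = ⊖12
rev ⊖12  = ⊕21

cmp : Label → Label
cmp ∅    = ∅
cmp av21 = av12
cmp av12 = av21
cmp ⊕21  = ⊖12
cmp ⊖12  = ⊕21

inv : Label → Label
inv ∅    = ∅
inv av21 = av21
inv av12 = av12
inv ⊕21  = ⊕21
inv ⊖12  = ⊖12

-- Gridding matrices: an m × n matrix has m columns and n rows;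
-- M i j is the entry in column i, row j (0-based Fin indices, so
-- Fin index i corresponds to the paper's column i+1, counted from the left,
-- and j to row j+1, counted from the bottom).

Matrix : ℕ → ℕ → Set
Matrix m n = Fin m → Fin n → Label

data GridMap : ℕ → ℕ → ℕ → ℕ → Set where
  gid      : ∀ {m n} → GridMap m n m n
  ginverse : ∀ {m n} → GridMap m n n m
  gcolRev  : ∀ {m n} → Fin m → GridMap m n m n
  growComp : ∀ {m n} → Fin n → GridMap m n m n
  gcolPerm : ∀ {m n} → Permutation′ m → GridMap m n m n
  growPerm : ∀ {m n} → Permutation′ n → GridMap m n m n
  _∘g_     : ∀ {m n m' n' m'' n''} →
             GridMap m' n' m'' n'' → GridMap m n m' n' → GridMap m n m'' n''

applyGM : ∀ {m n m' n'} → GridMap m n m' n' → Matrix m n → Matrix m' n'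
applyGM gid          M i j = M i j
applyGM ginverse     M i j = inv (M j i)
applyGM (gcolRev c)  M i j = if toℕ i ≡ᵇ toℕ c then rev (M i j) else M i j
applyGM (growComp r) M i j = if toℕ j ≡ᵇ toℕ r then cmp (M i j) else M i j
applyGM (gcolPerm μ) M i j = M (μ ⟨$⟩ʳ i) j
applyGM (growPerm ν) M i j = M i (ν ⟨$⟩ʳ j)
applyGM (f ∘g g)     M i j = applyGM f (applyGM g M) i j

GridEquivalent : ∀ {m n m' n'} → Matrix m n → Matrix m' n' → Set
GridEquivalent {m} {n} {m'} {n'} M N =
  Σ (GridMap m n m' n') λ f → ∀ i j → applyGM f M i j ≡ N i j

Cell : ℕ → ℕ → Set
Cell m n = Fin m × Fin n

NonEmpty : ∀ {m n} → Matrix m n → Cell m n → Set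
NonEmpty M (i , j) = M i j ≢ ∅

StrictlyBetween : ∀ {p} → Fin p → Fin p → Fin p → Set
StrictlyBetween a b x = (a < x × x < b) ⊎ (b < x × x < a)

Adjacent : ∀ {m n} → Matrix m n → Cell m n → Cell m n → Set
Adjacent M (i , j) (i' , j') =
  NonEmpty M (i , j) × NonEmpty M (i' , j') ×
  ((i ≡ i' × j ≢ j' × (∀ y → StrictlyBetween j j' y → M i y ≡ ∅))
   ⊎ (j ≡ j' × i ≢ i' × (∀ x → StrictlyBetween i i' x → M x j ≡ ∅)))

Consecutive : ∀ {p} → Fin p → Fin p → Set
Consecutive s t = (suc (toℕ s) ≡ toℕ t) ⊎ (suc (toℕ t) ≡ toℕ s)

IsPathVia : ∀ {m n} → Matrix m n → (k : ℕ) → (Fin (suc k) → Cell m n) → Set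
IsPathVia {m} {n} M k v =
  Injective _≡_ _≡_ v ×
  (∀ t → NonEmpty M (v t)) ×
  (∀ (c : Cell m n) → NonEmpty M c → ∃ λ t → v t ≡ c) ×
  (∀ s t → (Adjacent M (v s) (v t) → Consecutive s t)
         × (Consecutive s t → Adjacent M (v s) (v t)))

IsEndLabel : Label → Set
IsEndLabel ℓ = (ℓ ≡ ⊕21) ⊎ (ℓ ≡ ⊖12)

IsInternalLabel : Label → Set
IsInternalLabel ℓ = (ℓ ≡ av21) ⊎ (ℓ ≡ av12)

lab : ∀ {m n} → Matrix m n → Cell m n → Label
lab M (i , j) = M i j

LabelledPath : ∀ {m n} → Matrix m n → ℕ → Set
LabelledPath {m} {n} M k =
  Σ (Fin (suc k) → Cell m n) λ v →
    IsPathVia M k v ×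
    (∀ t → (toℕ t ≡ 0 ⊎ toℕ t ≡ k) → IsEndLabel (lab M (v t))) ×
    (∀ t → toℕ t ≢ 0 → toℕ t ≢ k → IsInternalLabel (lab M (v t)))

NoEmptyLines : ∀ {m n} → Matrix m n → Set
NoEmptyLines {m} {n} M =
  (∀ (i : Fin m) → ∃ λ (j : Fin n) → M i j ≢ ∅) ×
  (∀ (j : Fin n) → ∃ λ (i : Fin m) → M i j ≢ ∅)

AtMostTwoPerLine : ∀ {m n} → Matrix m n → Set
AtMostTwoPerLine {m} {n} M =
  (∀ (i : Fin m) (a b c : Fin n) → a < b → b < c →
     M i a ≢ ∅ → M i b ≢ ∅ → M i c ≢ ∅ → ⊥) ×
  (∀ (j : Fin n) (a b c : Fin m) → a < b → b < c →
     M a j ≢ ∅ → M b j ≢ ∅ → M c j ≢ ∅ → ⊥)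

-- The matrices M^k.  Entries are given with the paper's 1-based indices
-- (column i, row j); k = 4ℓ + r with r ∈ {1,2,3,4}.

-- C = D⁺ = ⊕21, D⁻ = ⊖12
private
  infix 4 _==_
  _==_ : ℕ → ℕ → Bool
  _==_ = _≡ᵇ_
  inR : ℕ → ℕ → ℕ → Bool
  inR a b x = (a ≤ᵇ x) ∧ (x ≤ᵇ b)

mk1 mk2 mk3 mk4 : ℕ → ℕ → ℕ → Label
mk1 zero i j =
  if (i == 1) ∧ (j == 1) then ⊕21 else
  if (i == 2) ∧ (j == 1) then ⊖12 else ∅
-- k = 4ℓ+1, ℓ ≥ 1, size (2ℓ+2) × (2ℓ+1); M^{k-1} = M^{4(ℓ-1)+4}
mk1 (suc ℓ') i j =
  let ℓ = suc ℓ' in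
  if inR 1 (2 * ℓ + 1) i ∧ inR 2 (2 * ℓ + 1) j then mk4 ℓ' i j else
  if (i == 2 * ℓ + 2) ∧ (j == 1) then ⊖12 else
  if (i == 1) ∧ (j == 1) then av21 else ∅
-- k = 4ℓ+2, size (2ℓ+2) × (2ℓ+2)
mk2 ℓ i j =
  if inR 1 (2 * ℓ + 1) i ∧ inR 1 (2 * ℓ + 1) j then mk1 ℓ i j else
  if (i == 2 * ℓ + 2) ∧ (j == 2 * ℓ + 2) then ⊕21 else
  if (i == 2 * ℓ + 2) ∧ (j == 1) then av12 else ∅
-- k = 4ℓ+3, size (2ℓ+3) × (2ℓ+2)
mk3 ℓ i j =
  if inR 2 (2 * ℓ + 3) i ∧ inR 1 (2 * ℓ + 1) j then mk2 ℓ (i ∸ 1) j else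
  if (i == 1) ∧ (j == 2 * ℓ + 2) then ⊖12 else
  if (i == 2 * ℓ + 3) ∧ (j == 2 * ℓ + 2) then av21 else ∅
-- k = 4ℓ+4, size (2ℓ+3) × (2ℓ+3).
-- NOTE: the paper prints the copied range as i ∈ [1,2ℓ+2]; this is a typo
-- (it would delete the last column of M^{k-1}); the intended range, by
-- symmetry with the case k = 4ℓ+1, is i ∈ [2,2ℓ+3].
mk4 ℓ i j =
  if inR 2 (2 * ℓ + 3) i ∧ inR 2 (2 * ℓ + 3) j then mk3 ℓ i (j ∸ 1) else
  if (i == 1) ∧ (j == 1) then ⊕21 else
  if (i == 1) ∧ (j == 2 * ℓ + 3) then av12 else ∅

data Residue : Set where
  r1 r2 r3 r4 : Residue

-- k ↦ (ℓ , r) with k = 4ℓ + r, for k ≥ 1 (k = 0 gives junk, never used)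
decomp : ℕ → ℕ × Residue
decomp zero = (0 , r1)
decomp (suc zero) = (0 , r1)
decomp (suc (suc zero)) = (0 , r2)
decomp (suc (suc (suc zero))) = (0 , r3)
decomp (suc (suc (suc (suc zero)))) = (0 , r4)
decomp (suc (suc (suc (suc (suc k))))) with decomp (suc k)
... | (ℓ , r) = (suc ℓ , r)

colsR rowsR : ℕ → Residue → ℕ
colsR ℓ r1 = 2 * ℓ + 2
colsR ℓ r2 = 2 * ℓ + 2
colsR ℓ r3 = 2 * ℓ + 3
colsR ℓ r4 = 2 * ℓ + 3
rowsR ℓ r1 = 2 * ℓ + 1
rowsR ℓ r2 = 2 * ℓ + 2
rowsR ℓ r3 = 2 * ℓ + 2
rowsR ℓ r4 = 2 * ℓ + 3

entR : ℕ → Residue → ℕ → ℕ → Label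
entR ℓ r1 = mk1 ℓ
entR ℓ r2 = mk2 ℓ
entR ℓ r3 = mk3 ℓ
entR ℓ r4 = mk4 ℓ

colsM rowsM : ℕ → ℕ
colsM k = colsR (proj₁ (decomp k)) (proj₂ (decomp k))
rowsM k = rowsR (proj₁ (decomp k)) (proj₂ (decomp k))

Mk : (k : ℕ) → Matrix (colsM k) (rowsM k)
Mk k i j = entR (proj₁ (decomp k)) (proj₂ (decomp k)) (suc (toℕ i)) (suc (toℕ j))

-- Up to reordering rows and columns, a matrix satisfying the hypotheses is a staircase: listing
-- its path as v 0, …, v k with a horizontal first step (transpose first otherwise), vertex t lies
-- in column ⌈t/2⌉ and row ⌊t/2⌋ of the reordered grid, since consecutive steps alternate between
-- rows and columns and a line meets only consecutive vertices. Two such staircases with the same k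
-- differ only in their labels, each of which is either right or reversed; reversing a column and
-- complementing a row both swap ⊕21 ↔ ⊖12 and Av(21) ↔ Av(12), so reversing each column and
-- complementing each row according to the parity of the label mismatches along the path before it
-- repairs every label. Finally M^k is such a staircase by induction on k: it arises from M^(k-1) by
-- appending a new column or row, on the right, top, left or bottom in turn, that holds the new end.

module Submission where

open import Defs
open import Data.Bool.Base using (Bool; true; false; if_then_else_; _∧_; _xor_; T)
open import Data.Bool.Properties
  using (∧-zeroʳ; ∧-identityʳ; xor-identityʳ; xor-assoc; xor-same; xor-comm; T-≡)
open import Data.Empty using (⊥; ⊥-elim)
open import Data.Fin.Base using (Fin; toℕ; fromℕ<)
import Data.Fin.Base as F
open import Data.Fin.Permutation
  using (Permutation; Permutation′; _⟨$⟩ʳ_; _⟨$⟩ˡ_; inverseʳ; ↔⇒≡; _∘ₚ_)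
import Data.Fin.Permutation as Perm
open import Data.Fin.Properties using (toℕ<n; toℕ-injective; toℕ-fromℕ<)
open import Data.List.Base using (List; []; _∷_; tabulate; allFin)
open import Data.Nat.Base
open import Data.Nat.Properties
open import Data.Nat.Tactic.RingSolver using (solve-∀)
open import Data.Product using (Σ; ∃; _×_; _,_; proj₁; proj₂; swap)
open import Data.Sum using (_⊎_; inj₁; inj₂)
open import Function.Base using (_∘_; id)
open import Function.Bundles using (mk⤖; Equivalence)
open import Function.Consequences.Propositional using (strictlySurjective⇒surjective)
open import Function.Definitions using (Injective; StrictlySurjective)
open import Function.Properties.Bijection using (⤖⇒↔)
open import Relation.Binary.Definitions using (tri<; tri≈; tri>)
open import Relation.Binary.PropositionalEquality
open import Relation.Nullary using (¬_; Dec; yes; no)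
open import Relation.Nullary.Decidable using (_⊎-dec_)

rev-involutive : ∀ x → rev (rev x) ≡ x
rev-involutive ∅    = refl
rev-involutive av21 = refl
rev-involutive av12 = refl
rev-involutive ⊕21  = refl
rev-involutive ⊖12  = refl

cmp≗rev : ∀ x → cmp x ≡ rev x
cmp≗rev ∅    = refl
cmp≗rev av21 = refl
cmp≗rev av12 = refl
cmp≗rev ⊕21  = refl
cmp≗rev ⊖12  = refl

inv≗id : ∀ x → inv x ≡ x
inv≗id ∅    = refl
inv≗id av21 = refl
inv≗id av12 = refl
inv≗id ⊕21  = refl
inv≗id ⊖12  = refl

reverseIf : Bool → Label → Label
reverseIf b x = if b then rev x else x

reverseIf-xor : ∀ b c x → reverseIf b (reverseIf c x) ≡ reverseIf (b xor c) x
reverseIf-xor false c     x = refl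
reverseIf-xor true  false x = refl
reverseIf-xor true  true  x = rev-involutive x

reverseIf-∅ : ∀ b → reverseIf b ∅ ≡ ∅
reverseIf-∅ false = refl
reverseIf-∅ true  = refl

complementIf≗reverseIf : ∀ b x → (if b then cmp x else x) ≡ reverseIf b x
complementIf≗reverseIf false x = refl
complementIf≗reverseIf true  x = cmp≗rev x

needsReversal : Label → Label → Bool
needsReversal ⊕21  ⊖12  = true
needsReversal ⊖12  ⊕21  = true
needsReversal av21 av12 = true
needsReversal av12 av21 = true
needsReversal _    _    = false

reverseIf-needsReversal-end : ∀ {x y} → IsEndLabel x → IsEndLabel y →
                              reverseIf (needsReversal x y) x ≡ y
reverseIf-needsReversal-end (inj₁ refl) (inj₁ refl) = refl
reverseIf-needsReversal-end (inj₁ refl) (inj₂ refl) = refl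
reverseIf-needsReversal-end (inj₂ refl) (inj₁ refl) = refl
reverseIf-needsReversal-end (inj₂ refl) (inj₂ refl) = refl

reverseIf-needsReversal-internal : ∀ {x y} → IsInternalLabel x → IsInternalLabel y →
                                   reverseIf (needsReversal x y) x ≡ y
reverseIf-needsReversal-internal (inj₁ refl) (inj₁ refl) = refl
reverseIf-needsReversal-internal (inj₁ refl) (inj₂ refl) = refl
reverseIf-needsReversal-internal (inj₂ refl) (inj₁ refl) = refl
reverseIf-needsReversal-internal (inj₂ refl) (inj₂ refl) = refl

xor-cancelˡ : ∀ b c → b xor (b xor c) ≡ c
xor-cancelˡ b c = trans (sym (xor-assoc b b c)) (cong (_xor c) (xor-same b))

-- A column listed several times is reversed once per occurrence, hence the parity.
reversalParity : ∀ {m} → (Fin m → Bool) → Fin m → List (Fin m) → Bool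
reversalParity g i []       = false
reversalParity g i (c ∷ cs) = ((toℕ i ≡ᵇ toℕ c) ∧ g c) xor reversalParity g i cs

reversalParity-zero : ∀ {m n} (g : Fin (suc n) → Bool) (h : Fin m → Fin n) →
                      reversalParity g F.zero (tabulate (F.suc ∘ h)) ≡ false
reversalParity-zero {zero}  g h = refl
reversalParity-zero {suc m} g h = reversalParity-zero g (h ∘ F.suc)

reversalParity-suc : ∀ {m n} (g : Fin (suc n) → Bool) i (h : Fin m → Fin n) →
                     reversalParity g (F.suc i) (tabulate (F.suc ∘ h)) ≡ reversalParity (g ∘ F.suc) i (tabulate h)
reversalParity-suc {zero}  g i h = refl
reversalParity-suc {suc m} g i h = cong (((toℕ i ≡ᵇ toℕ (h F.zero)) ∧ g (F.suc (h F.zero))) xor_)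
                                        (reversalParity-suc g i (h ∘ F.suc))

reversalParity-allFin : ∀ {m} (g : Fin m → Bool) i → reversalParity g i (allFin m) ≡ g i
reversalParity-allFin {suc m} g F.zero    = trans (cong (g F.zero xor_) (reversalParity-zero g id))
                                                  (xor-identityʳ (g F.zero))
reversalParity-allFin {suc m} g (F.suc i) = trans (reversalParity-suc g i id)
                                                  (reversalParity-allFin (g ∘ F.suc) i)

reverseColumns : ∀ {m n} → (Fin m → Bool) → List (Fin m) → GridMap m n m n
reverseColumns g []       = gid
reverseColumns g (c ∷ cs) = (if g c then gcolRev c else gid) ∘g reverseColumns g cs

complementRows : ∀ {m n} → (Fin n → Bool) → List (Fin n) → GridMap m n m n
complementRows g []       = gid
complementRows g (c ∷ cs) = (if g c then growComp c else gid) ∘g complementRows g cs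

reverseColumns-action : ∀ {m n} (g : Fin m → Bool) cs (M : Matrix m n) i j →
  applyGM (reverseColumns g cs) M i j ≡ reverseIf (reversalParity g i cs) (M i j)
reverseColumns-action g []       M i j = refl
reverseColumns-action g (c ∷ cs) M i j with g c
... | false = trans (reverseColumns-action g cs M i j)
                    (cong (λ b → reverseIf (b xor reversalParity g i cs) (M i j))
                          (sym (∧-zeroʳ (toℕ i ≡ᵇ toℕ c))))
... | true = trans (cong (reverseIf (toℕ i ≡ᵇ toℕ c)) (reverseColumns-action g cs M i j))
                   (trans (reverseIf-xor (toℕ i ≡ᵇ toℕ c) (reversalParity g i cs) (M i j))
                          (cong (λ b → reverseIf (b xor reversalParity g i cs) (M i j))
                                (sym (∧-identityʳ (toℕ i ≡ᵇ toℕ c)))))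

complementRows-action : ∀ {m n} (g : Fin n → Bool) cs (M : Matrix m n) i j →
  applyGM (complementRows g cs) M i j ≡ reverseIf (reversalParity g j cs) (M i j)
complementRows-action g []       M i j = refl
complementRows-action g (c ∷ cs) M i j with g c
... | false = trans (complementRows-action g cs M i j)
                    (cong (λ b → reverseIf (b xor reversalParity g j cs) (M i j))
                          (sym (∧-zeroʳ (toℕ j ≡ᵇ toℕ c))))
... | true = trans (complementIf≗reverseIf (toℕ j ≡ᵇ toℕ c) _)
                   (trans (cong (reverseIf (toℕ j ≡ᵇ toℕ c)) (complementRows-action g cs M i j))
                   (trans (reverseIf-xor (toℕ j ≡ᵇ toℕ c) (reversalParity g j cs) (M i j))
                          (cong (λ b → reverseIf (b xor reversalParity g j cs) (M i j))
                                (sym (∧-identityʳ (toℕ j ≡ᵇ toℕ c))))))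

-- Staircases

OnStaircase : ℕ → ℕ → Set
OnStaircase a b = a ≡ b ⊎ a ≡ suc b

onStaircase? : ∀ a b → Dec (OnStaircase a b)
onStaircase? a b = (a ≟ b) ⊎-dec (a ≟ suc b)

-- Vertex t of the staircase path sits in column ⌈t/2⌉ and row ⌊t/2⌋, so the cell (a , b)
-- carries vertex a + b.
staircase : (ℕ → Label) → ℕ → ℕ → Label
staircase L a b with onStaircase? a b
... | yes _ = L (a + b)
... | no  _ = ∅

staircase-on : ∀ L {a b} → OnStaircase a b → staircase L a b ≡ L (a + b)
staircase-on L {a} {b} on with onStaircase? a b
... | yes _   = refl
... | no  off = ⊥-elim (off on)

staircase-off : ∀ L {a b} → ¬ OnStaircase a b → staircase L a b ≡ ∅
staircase-off L {a} {b} off with onStaircase? a b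
... | yes on = ⊥-elim (off on)
... | no  _  = refl

halves-onStaircase : ∀ t → OnStaircase ⌈ t /2⌉ ⌊ t /2⌋
halves-onStaircase zero                = inj₁ refl
halves-onStaircase (suc zero)          = inj₂ refl
halves-onStaircase (suc (suc t)) with halves-onStaircase t
... | inj₁ e = inj₁ (cong suc e)
... | inj₂ e = inj₂ (cong suc e)

⌈n/2⌉+⌊n/2⌋≡n : ∀ t → ⌈ t /2⌉ + ⌊ t /2⌋ ≡ t
⌈n/2⌉+⌊n/2⌋≡n t = trans (+-comm ⌈ t /2⌉ ⌊ t /2⌋) (⌊n/2⌋+⌈n/2⌉≡n t)

onStaircase-halves : ∀ {a b} → OnStaircase a b → ⌈ a + b /2⌉ ≡ a × ⌊ a + b /2⌋ ≡ b
onStaircase-halves {b = b} (inj₁ refl) = sym (n≡⌈n+n/2⌉ b) , sym (n≡⌊n+n/2⌋ b)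
onStaircase-halves {b = b} (inj₂ refl) = cong suc (sym (n≡⌊n+n/2⌋ b)) , sym (n≡⌈n+n/2⌉ b)

halves-≤ : ∀ {a b} k → a ≤ ⌈ k /2⌉ → b ≤ ⌊ k /2⌋ → a + b ≤ k
halves-≤ k a≤ b≤ = ≤-trans (+-mono-≤ a≤ b≤) (≤-reflexive (⌈n/2⌉+⌊n/2⌋≡n k))

⌈n/2⌉≤1+⌊n/2⌋ : ∀ n → ⌈ n /2⌉ ≤ suc ⌊ n /2⌋
⌈n/2⌉≤1+⌊n/2⌋ n with halves-onStaircase n
... | inj₁ even = ≤-trans (≤-reflexive even) (n≤1+n ⌊ n /2⌋)
... | inj₂ odd  = ≤-reflexive odd

sameCeiling⇒next : ∀ {s t} → s < t → ⌈ s /2⌉ ≡ ⌈ t /2⌉ → t ≡ suc s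
sameCeiling⇒next {s} {t} s<t eq with m≤n⇒m<n∨m≡n s<t
... | inj₂ t≡1+s = sym t≡1+s
... | inj₁ 1+s<t = ⊥-elim (<⇒≢ {⌈ s /2⌉} {⌈ t /2⌉} (⌈n/2⌉-mono 1+s<t) eq)

sameFloor⇒next : ∀ {s t} → s < t → ⌊ s /2⌋ ≡ ⌊ t /2⌋ → t ≡ suc s
sameFloor⇒next {s} {t} s<t eq with m≤n⇒m<n∨m≡n s<t
... | inj₂ t≡1+s = sym t≡1+s
... | inj₁ 1+s<t = ⊥-elim (<⇒≢ {⌊ s /2⌋} {⌊ t /2⌋} (⌊n/2⌋-mono 1+s<t) eq)

record PathLabelling (L : ℕ → Label) (k : ℕ) : Set where
  field
    start    : IsEndLabel (L 0)
    finish   : IsEndLabel (L k)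
    internal : ∀ {t} → 0 < t → t < k → IsInternalLabel (L t)

matchingReversal : ∀ {L L′ k} → PathLabelling L k → PathLabelling L′ k →
                   ∀ t → t ≤ k → reverseIf (needsReversal (L t) (L′ t)) (L t) ≡ L′ t
matchingReversal {k = k} P P′ t t≤k with t ≟ 0 | t ≟ k
... | yes refl | _        = reverseIf-needsReversal-end (PathLabelling.start P) (PathLabelling.start P′)
... | no  _    | yes refl = reverseIf-needsReversal-end (PathLabelling.finish P) (PathLabelling.finish P′)
... | no  t≢0  | no  t≢k  = reverseIf-needsReversal-internal (PathLabelling.internal P 0<t t<k)
                                                            (PathLabelling.internal P′ 0<t t<k)
  where
  0<t = n≢0⇒n>0 t≢0
  t<k = ≤∧≢⇒< t≤k t≢k

prefixParity : (ℕ → Bool) → ℕ → Bool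
prefixParity β zero    = false
prefixParity β (suc t) = prefixParity β t xor β t

-- Reversing column a by the parity of the first 2a steps and row b by that of the first
-- 2b + 1 steps reverses the cell of vertex t exactly by β t, since {2a , 2b + 1} = {t , t + 1}.
prefixParity-staircase : ∀ β {a b} → OnStaircase a b →
                         prefixParity β (suc (b + b)) xor prefixParity β (a + a) ≡ β (a + b)
prefixParity-staircase β {b = b} (inj₁ refl) =
  trans (xor-comm (prefixParity β (b + b) xor β (b + b)) (prefixParity β (b + b)))
        (xor-cancelˡ (prefixParity β (b + b)) (β (b + b)))
prefixParity-staircase β {b = b} (inj₂ refl) =
  trans (cong (λ t → prefixParity β (suc (b + b)) xor prefixParity β (suc t)) (+-suc b b))
        (xor-cancelˡ (prefixParity β (suc (b + b))) (β (suc (b + b))))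

reverseIf-staircase : ∀ {L L′ k} β → (∀ t → t ≤ k → reverseIf (β t) (L t) ≡ L′ t) →
  ∀ a b → a + b ≤ k →
  reverseIf (prefixParity β (suc (b + b))) (reverseIf (prefixParity β (a + a)) (staircase L a b))
    ≡ staircase L′ a b
reverseIf-staircase {L} {L′} β match a b a+b≤k = byCell (onStaircase? a b)
  where
  open ≡-Reasoning
  rowParity columnParity : Bool
  rowParity    = prefixParity β (suc (b + b))
  columnParity = prefixParity β (a + a)

  byCell : Dec (OnStaircase a b) →
           reverseIf rowParity (reverseIf columnParity (staircase L a b)) ≡ staircase L′ a b
  byCell (yes on) = begin
    reverseIf rowParity (reverseIf columnParity (staircase L a b))
      ≡⟨ reverseIf-xor rowParity columnParity (staircase L a b) ⟩
    reverseIf (rowParity xor columnParity) (staircase L a b)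
      ≡⟨ cong₂ reverseIf (prefixParity-staircase β on) (staircase-on L on) ⟩
    reverseIf (β (a + b)) (L (a + b))
      ≡⟨ match (a + b) a+b≤k ⟩
    L′ (a + b)
      ≡⟨ sym (staircase-on L′ on) ⟩
    staircase L′ a b ∎
  byCell (no off) = begin
    reverseIf rowParity (reverseIf columnParity (staircase L a b))
      ≡⟨ cong (reverseIf rowParity ∘ reverseIf columnParity) (staircase-off L off) ⟩
    reverseIf rowParity (reverseIf columnParity ∅)
      ≡⟨ cong (reverseIf rowParity) (reverseIf-∅ columnParity) ⟩
    reverseIf rowParity ∅
      ≡⟨ reverseIf-∅ rowParity ⟩
    ∅
      ≡⟨ sym (staircase-off L′ off) ⟩
    staircase L′ a b ∎

record PermutedStaircase {m n} (M : Matrix m n) (k : ℕ) : Set where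
  field
    columnOrder : Permutation (suc ⌈ k /2⌉) m
    rowOrder    : Permutation (suc ⌊ k /2⌋) n
    label       : ℕ → Label
    labelling   : PathLabelling label k
    entry       : ∀ a b → M (columnOrder ⟨$⟩ʳ a) (rowOrder ⟨$⟩ʳ b) ≡ staircase label (toℕ a) (toℕ b)

module _ {k} {M N : Matrix (suc ⌈ k /2⌉) (suc ⌊ k /2⌋)}
         (S : PermutedStaircase M k) (T : PermutedStaircase N k) where

  open PermutedStaircase

  private
    β : ℕ → Bool
    β t = needsReversal (label S t) (label T t)

    reversedColumn : Fin (suc ⌈ k /2⌉) → Bool
    reversedColumn x = prefixParity β (a + a)
      where a = toℕ (columnOrder T ⟨$⟩ˡ x)

    complementedRow : Fin (suc ⌊ k /2⌋) → Bool
    complementedRow y = prefixParity β (suc (b + b))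
      where b = toℕ (rowOrder T ⟨$⟩ˡ y)

    realign : GridMap (suc ⌈ k /2⌉) (suc ⌊ k /2⌋) (suc ⌈ k /2⌉) (suc ⌊ k /2⌋)
    realign = growPerm (Perm.flip (rowOrder T) ∘ₚ rowOrder S)
           ∘g gcolPerm (Perm.flip (columnOrder T) ∘ₚ columnOrder S)

    relabel : GridMap (suc ⌈ k /2⌉) (suc ⌊ k /2⌋) (suc ⌈ k /2⌉) (suc ⌊ k /2⌋)
    relabel = complementRows complementedRow (allFin _) ∘g reverseColumns reversedColumn (allFin _)

    relabel-action : ∀ (P : Matrix (suc ⌈ k /2⌉) (suc ⌊ k /2⌋)) x y →
                     applyGM relabel P x y ≡ reverseIf (complementedRow y) (reverseIf (reversedColumn x) (P x y))
    relabel-action P x y = begin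
      applyGM relabel P x y
        ≡⟨ complementRows-action complementedRow (allFin _) _ x y ⟩
      reverseIf (reversalParity complementedRow y (allFin _))
                (applyGM (reverseColumns reversedColumn (allFin _)) P x y)
        ≡⟨ cong₂ reverseIf (reversalParity-allFin complementedRow y)
                           (reverseColumns-action reversedColumn (allFin _) P x y) ⟩
      reverseIf (complementedRow y) (reverseIf (reversalParity reversedColumn x (allFin _)) (P x y))
        ≡⟨ cong (λ c → reverseIf (complementedRow y) (reverseIf c (P x y)))
                (reversalParity-allFin reversedColumn x) ⟩
      reverseIf (complementedRow y) (reverseIf (reversedColumn x) (P x y)) ∎
      where open ≡-Reasoning

  equivalentOfSameShape : GridEquivalent M N
  equivalentOfSameShape = relabel ∘g realign , λ x y →
    let a = columnOrder T ⟨$⟩ˡ x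
        b = rowOrder T ⟨$⟩ˡ y
        open ≡-Reasoning in begin
    applyGM relabel (applyGM realign M) x y
      ≡⟨ relabel-action (applyGM realign M) x y ⟩
    reverseIf (complementedRow y) (reverseIf (reversedColumn x) (M (columnOrder S ⟨$⟩ʳ a) (rowOrder S ⟨$⟩ʳ b)))
      ≡⟨ cong (reverseIf (complementedRow y) ∘ reverseIf (reversedColumn x)) (entry S a b) ⟩
    reverseIf (complementedRow y) (reverseIf (reversedColumn x) (staircase (label S) (toℕ a) (toℕ b)))
      ≡⟨ reverseIf-staircase β (matchingReversal (labelling S) (labelling T)) (toℕ a) (toℕ b)
                             (halves-≤ k (≤-pred (toℕ<n a)) (≤-pred (toℕ<n b))) ⟩
    staircase (label T) (toℕ a) (toℕ b)
      ≡⟨ sym (entry T a b) ⟩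
    N (columnOrder T ⟨$⟩ʳ a) (rowOrder T ⟨$⟩ʳ b)
      ≡⟨ cong₂ N (inverseʳ (columnOrder T)) (inverseʳ (rowOrder T)) ⟩
    N x y ∎

permutedStaircases-equivalent : ∀ {k m n m′ n′} {M : Matrix m n} {N : Matrix m′ n′} →
  PermutedStaircase M k → PermutedStaircase N k → GridEquivalent M N
permutedStaircases-equivalent S T = sameShape (↔⇒≡ (columnOrder S)) (↔⇒≡ (rowOrder S))
                                              (↔⇒≡ (columnOrder T)) (↔⇒≡ (rowOrder T)) S T
  where
  open PermutedStaircase
  sameShape : ∀ {k m n m′ n′} {M : Matrix m n} {N : Matrix m′ n′} →
    suc ⌈ k /2⌉ ≡ m → suc ⌊ k /2⌋ ≡ n → suc ⌈ k /2⌉ ≡ m′ → suc ⌊ k /2⌋ ≡ n′ →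
    PermutedStaircase M k → PermutedStaircase N k → GridEquivalent M N
  sameShape refl refl refl refl = equivalentOfSameShape

-- Matrices whose graph is a path

clamp : (k : ℕ) → ℕ → Fin (suc k)
clamp k       zero    = F.zero
clamp zero    (suc t) = F.zero
clamp (suc k) (suc t) = F.suc (clamp k t)

toℕ-clamp : ∀ k {t} → t ≤ k → toℕ (clamp k t) ≡ t
toℕ-clamp k       {zero}  _         = refl
toℕ-clamp (suc k) {suc t} (s≤s t≤k) = cong suc (toℕ-clamp k t≤k)

clamp-toℕ : ∀ k (i : Fin (suc k)) → clamp k (toℕ i) ≡ i
clamp-toℕ k       F.zero    = refl
clamp-toℕ (suc k) (F.suc i) = cong F.suc (clamp-toℕ k i)

isEmpty? : ∀ x → Dec (x ≡ ∅)
isEmpty? ∅    = yes refl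
isEmpty? av21 = no (λ ())
isEmpty? av12 = no (λ ())
isEmpty? ⊕21  = no (λ ())
isEmpty? ⊖12  = no (λ ())

emptyBetween : ∀ {p} (line : Fin p → Label) →
  (∀ a b c → a F.< b → b F.< c → line a ≢ ∅ → line b ≢ ∅ → line c ≢ ∅ → ⊥) →
  ∀ {a b} → line a ≢ ∅ → line b ≢ ∅ → ∀ x → StrictlyBetween a b x → line x ≡ ∅
emptyBetween line atMostTwo {a} {b} a≢∅ b≢∅ x between with isEmpty? (line x)
... | yes x≡∅ = x≡∅
... | no  x≢∅ with between
...   | inj₁ (a<x , x<b) = ⊥-elim (atMostTwo a x b a<x x<b a≢∅ x≢∅ b≢∅)
...   | inj₂ (b<x , x<a) = ⊥-elim (atMostTwo b x a b<x x<a b≢∅ x≢∅ a≢∅)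

permutationOf : ∀ {m n} (f : Fin m → Fin n) →
                Injective _≡_ _≡_ f → StrictlySurjective _≡_ f → Permutation m n
permutationOf f injective surjective = ⤖⇒↔ (mk⤖ (injective , strictlySurjective⇒surjective surjective))

equal-from-ordered : ∀ {A B : Set} (f : ℕ → A) (g : ℕ → B) k →
  (∀ {s t} → s < t → t ≤ k → f s ≡ f t → g s ≡ g t) →
  ∀ {s t} → s ≤ k → t ≤ k → f s ≡ f t → g s ≡ g t
equal-from-ordered f g k ordered {s} {t} s≤k t≤k eq with <-cmp s t
... | tri< s<t _ _    = ordered s<t t≤k eq
... | tri≈ _ refl _   = refl
... | tri> _ _ t<s    = sym (ordered t<s s≤k (sym eq))

module PathMatrix {m n} {M : Matrix m n} {k : ℕ}
                  (noEmptyLines : NoEmptyLines M) (atMostTwo : AtMostTwoPerLine M)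
                  {v : Fin (suc k) → Cell m n} (path : IsPathVia M k v) where

  private
    v-injective : Injective _≡_ _≡_ v
    v-injective = proj₁ path

    v-nonEmpty : ∀ t → NonEmpty M (v t)
    v-nonEmpty = proj₁ (proj₂ path)

    covers : ∀ c → NonEmpty M c → ∃ λ t → v t ≡ c
    covers = proj₁ (proj₂ (proj₂ path))

    adjacent⇒consecutive : ∀ s t → Adjacent M (v s) (v t) → Consecutive s t
    adjacent⇒consecutive s t = proj₁ (proj₂ (proj₂ (proj₂ path)) s t)

    consecutive⇒adjacent : ∀ s t → Consecutive s t → Adjacent M (v s) (v t)
    consecutive⇒adjacent s t = proj₂ (proj₂ (proj₂ (proj₂ path)) s t)

  col : ℕ → Fin m
  col t = proj₁ (v (clamp k t))

  row : ℕ → Fin n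
  row t = proj₂ (v (clamp k t))

  vertexLabel : ℕ → Label
  vertexLabel t = M (col t) (row t)

  clamp-distinct : ∀ {s t} → s < t → t ≤ k → clamp k s ≢ clamp k t
  clamp-distinct {s} {t} s<t t≤k eq =
    <⇒≢ s<t (trans (sym (toℕ-clamp k (<⇒≤ (<-≤-trans s<t t≤k))))
                   (trans (cong toℕ eq) (toℕ-clamp k t≤k)))

  consecutive⇒next : ∀ {s t} → s < t → t ≤ k → Consecutive (clamp k s) (clamp k t) → t ≡ suc s
  consecutive⇒next {s} {t} s<t t≤k (inj₁ eq) =
    trans (sym (toℕ-clamp k t≤k)) (trans (sym eq) (cong suc (toℕ-clamp k (<⇒≤ (<-≤-trans s<t t≤k)))))
  consecutive⇒next {s} {t} s<t t≤k (inj₂ eq) =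
    ⊥-elim (<-asym s<t (subst₂ _<_ (toℕ-clamp k t≤k) (toℕ-clamp k (<⇒≤ (<-≤-trans s<t t≤k)))
                              (≤-reflexive eq)))

  distinct : ∀ {s t} → s < t → t ≤ k → col s ≡ col t → row s ≡ row t → ⊥
  distinct s<t t≤k sameCol sameRow = clamp-distinct s<t t≤k (v-injective (cong₂ _,_ sameCol sameRow))

  sameColumn⇒next : ∀ {s t} → s < t → t ≤ k → col s ≡ col t → t ≡ suc s
  sameColumn⇒next {s} {t} s<t t≤k sameCol =
    consecutive⇒next s<t t≤k (adjacent⇒consecutive _ _
      (v-nonEmpty _ , v-nonEmpty _ ,
       inj₁ (sameCol , distinct s<t t≤k sameCol ,
             emptyBetween (M (col s)) (proj₁ atMostTwo (col s)) (v-nonEmpty _) t-in-column)))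
    where
    t-in-column : M (col s) (row t) ≢ ∅
    t-in-column = subst (λ i → M i (row t) ≢ ∅) (sym sameCol) (v-nonEmpty (clamp k t))

  sameRow⇒next : ∀ {s t} → s < t → t ≤ k → row s ≡ row t → t ≡ suc s
  sameRow⇒next {s} {t} s<t t≤k sameRow =
    consecutive⇒next s<t t≤k (adjacent⇒consecutive _ _
      (v-nonEmpty _ , v-nonEmpty _ ,
       inj₂ (sameRow , (λ sameCol → distinct s<t t≤k sameCol sameRow) ,
             emptyBetween (λ x → M x (row s)) (proj₂ atMostTwo (row s)) (v-nonEmpty _) t-in-row)))
    where
    t-in-row : M (col t) (row s) ≢ ∅
    t-in-row = subst (λ j → M (col t) j ≢ ∅) (sym sameRow) (v-nonEmpty (clamp k t))

  step : ∀ t → suc t ≤ k → col t ≡ col (suc t) ⊎ row t ≡ row (suc t)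
  step t t<k with proj₂ (proj₂ (consecutive⇒adjacent (clamp k t) (clamp k (suc t)) consecutive))
    where
    consecutive : Consecutive (clamp k t) (clamp k (suc t))
    consecutive = inj₁ (trans (cong suc (toℕ-clamp k (<⇒≤ t<k))) (sym (toℕ-clamp k t<k)))
  ... | inj₁ (sameCol , _) = inj₁ sameCol
  ... | inj₂ (sameRow , _) = inj₂ sameRow

  module Horizontal (firstRow : row 0 ≡ row 1) where

    -- Steps alternate: vertices 2u, 2u + 1 share a row and 2u + 1, 2u + 2 share a column,
    -- because two steps in the same line would put three vertices in it.
    steps : ∀ s → suc s ≤ k →
            (⌈ s /2⌉ ≡ ⌊ s /2⌋ → row s ≡ row (suc s)) ×
            (⌈ s /2⌉ ≡ suc ⌊ s /2⌋ → col s ≡ col (suc s))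
    steps zero    _       = (λ _ → firstRow) , (λ ())
    steps (suc s) s+2≤k = rowStep , columnStep
      where
      previous = steps s (≤-trans (n≤1+n (suc s)) s+2≤k)
      s<s+2 : s < suc (suc s)
      s<s+2 = s≤s (n≤1+n s)

      rowStep : suc ⌊ s /2⌋ ≡ ⌈ s /2⌉ → row (suc s) ≡ row (suc (suc s))
      rowStep odd with step (suc s) s+2≤k
      ... | inj₂ sameRow = sameRow
      ... | inj₁ sameCol = ⊥-elim (1+n≢n (sameColumn⇒next s<s+2 s+2≤k
                                            (trans (proj₂ previous (sym odd)) sameCol)))

      columnStep : suc ⌊ s /2⌋ ≡ suc ⌈ s /2⌉ → col (suc s) ≡ col (suc (suc s))
      columnStep even with step (suc s) s+2≤k
      ... | inj₁ sameCol = sameCol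
      ... | inj₂ sameRow = ⊥-elim (1+n≢n (sameRow⇒next s<s+2 s+2≤k
                                            (trans (proj₁ previous (sym (suc-injective even))) sameRow)))

    columnsAgree : ∀ {s t} → s ≤ k → t ≤ k → ⌈ s /2⌉ ≡ ⌈ t /2⌉ → col s ≡ col t
    columnsAgree = equal-from-ordered ⌈_/2⌉ col k ordered
      where
      ordered : ∀ {s t} → s < t → t ≤ k → ⌈ s /2⌉ ≡ ⌈ t /2⌉ → col s ≡ col t
      ordered {s} s<t t≤k eq with sameCeiling⇒next s<t eq
      ... | refl = proj₂ (steps s t≤k) eq

    rowsAgree : ∀ {s t} → s ≤ k → t ≤ k → ⌊ s /2⌋ ≡ ⌊ t /2⌋ → row s ≡ row t
    rowsAgree = equal-from-ordered ⌊_/2⌋ row k ordered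
      where
      ordered : ∀ {s t} → s < t → t ≤ k → ⌊ s /2⌋ ≡ ⌊ t /2⌋ → row s ≡ row t
      ordered {s} s<t t≤k eq with sameFloor⇒next s<t eq
      ... | refl = proj₁ (steps s t≤k) (sym eq)

    sameColumn⇒sameCeiling : ∀ {s t} → s ≤ k → t ≤ k → col s ≡ col t → ⌈ s /2⌉ ≡ ⌈ t /2⌉
    sameColumn⇒sameCeiling = equal-from-ordered col ⌈_/2⌉ k ordered
      where
      ordered : ∀ {s t} → s < t → t ≤ k → col s ≡ col t → ⌈ s /2⌉ ≡ ⌈ t /2⌉
      ordered {s} s<t t≤k sameCol with sameColumn⇒next s<t t≤k sameCol | halves-onStaircase s
      ... | refl | inj₂ odd  = odd
      ... | refl | inj₁ even = ⊥-elim (distinct s<t t≤k sameCol (proj₁ (steps s t≤k) even))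

    sameRow⇒sameFloor : ∀ {s t} → s ≤ k → t ≤ k → row s ≡ row t → ⌊ s /2⌋ ≡ ⌊ t /2⌋
    sameRow⇒sameFloor = equal-from-ordered row ⌊_/2⌋ k ordered
      where
      ordered : ∀ {s t} → s < t → t ≤ k → row s ≡ row t → ⌊ s /2⌋ ≡ ⌊ t /2⌋
      ordered {s} s<t t≤k sameRow with sameRow⇒next s<t t≤k sameRow | halves-onStaircase s
      ... | refl | inj₁ even = sym even
      ... | refl | inj₂ odd  = ⊥-elim (distinct s<t t≤k (proj₂ (steps s t≤k) odd) sameRow)

    columnVertex : ℕ → ℕ
    columnVertex zero    = zero
    columnVertex (suc a) = suc (a + a)

    ⌈columnVertex/2⌉ : ∀ a → ⌈ columnVertex a /2⌉ ≡ a
    ⌈columnVertex/2⌉ zero    = refl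
    ⌈columnVertex/2⌉ (suc a) = cong suc (sym (n≡⌊n+n/2⌋ a))

    columnVertex-≤ : ∀ {a} → a ≤ ⌈ k /2⌉ → columnVertex a ≤ k
    columnVertex-≤ {zero}  _        = z≤n
    columnVertex-≤ {suc a} 1+a≤⌈k/2⌉ =
      halves-≤ k 1+a≤⌈k/2⌉ (≤-pred (≤-trans 1+a≤⌈k/2⌉ (⌈n/2⌉≤1+⌊n/2⌋ k)))

    rowVertex-≤ : ∀ {b} → b ≤ ⌊ k /2⌋ → b + b ≤ k
    rowVertex-≤ b≤⌊k/2⌋ = halves-≤ k (≤-trans b≤⌊k/2⌋ (⌊n/2⌋≤⌈n/2⌉ k)) b≤⌊k/2⌋

    columnOf : Fin (suc ⌈ k /2⌉) → Fin m
    columnOf a = col (columnVertex (toℕ a))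

    rowOf : Fin (suc ⌊ k /2⌋) → Fin n
    rowOf b = row (toℕ b + toℕ b)

    columnOf-≤ : ∀ a → columnVertex (toℕ {suc ⌈ k /2⌉} a) ≤ k
    columnOf-≤ a = columnVertex-≤ (≤-pred (toℕ<n a))

    rowOf-≤ : ∀ b → toℕ {suc ⌊ k /2⌋} b + toℕ b ≤ k
    rowOf-≤ b = rowVertex-≤ (≤-pred (toℕ<n b))

    columnOf-injective : Injective _≡_ _≡_ columnOf
    columnOf-injective {a} {a′} eq = toℕ-injective (begin
      toℕ a                         ≡⟨ sym (⌈columnVertex/2⌉ (toℕ a)) ⟩
      ⌈ columnVertex (toℕ a) /2⌉    ≡⟨ sameColumn⇒sameCeiling (columnOf-≤ a) (columnOf-≤ a′) eq ⟩
      ⌈ columnVertex (toℕ a′) /2⌉   ≡⟨ ⌈columnVertex/2⌉ (toℕ a′) ⟩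
      toℕ a′                        ∎)
      where open ≡-Reasoning

    rowOf-injective : Injective _≡_ _≡_ rowOf
    rowOf-injective {b} {b′} eq = toℕ-injective (begin
      toℕ b                   ≡⟨ n≡⌊n+n/2⌋ (toℕ b) ⟩
      ⌊ toℕ b + toℕ b /2⌋     ≡⟨ sameRow⇒sameFloor (rowOf-≤ b) (rowOf-≤ b′) eq ⟩
      ⌊ toℕ b′ + toℕ b′ /2⌋   ≡⟨ sym (n≡⌊n+n/2⌋ (toℕ b′)) ⟩
      toℕ b′                  ∎)
      where open ≡-Reasoning

    columnIndex : Fin (suc k) → Fin (suc ⌈ k /2⌉)
    columnIndex t = fromℕ< (s≤s (⌈n/2⌉-mono (≤-pred (toℕ<n t))))

    rowIndex : Fin (suc k) → Fin (suc ⌊ k /2⌋)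
    rowIndex t = fromℕ< (s≤s (⌊n/2⌋-mono (≤-pred (toℕ<n t))))

    columnOf-columnIndex : ∀ t → columnOf (columnIndex t) ≡ proj₁ (v t)
    columnOf-columnIndex t = begin
      col (columnVertex (toℕ (columnIndex t)))
        ≡⟨ columnsAgree (columnOf-≤ (columnIndex t)) (≤-pred (toℕ<n t))
                        (trans (⌈columnVertex/2⌉ _) (toℕ-fromℕ< _)) ⟩
      col (toℕ t)
        ≡⟨ cong (proj₁ ∘ v) (clamp-toℕ k t) ⟩
      proj₁ (v t) ∎
      where open ≡-Reasoning

    rowOf-rowIndex : ∀ t → rowOf (rowIndex t) ≡ proj₂ (v t)
    rowOf-rowIndex t = begin
      row (toℕ (rowIndex t) + toℕ (rowIndex t))
        ≡⟨ rowsAgree (rowOf-≤ (rowIndex t)) (≤-pred (toℕ<n t))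
                     (trans (sym (n≡⌊n+n/2⌋ _)) (toℕ-fromℕ< _)) ⟩
      row (toℕ t)
        ≡⟨ cong (proj₂ ∘ v) (clamp-toℕ k t) ⟩
      proj₂ (v t) ∎
      where open ≡-Reasoning

    columnOf-surjective : StrictlySurjective _≡_ columnOf
    columnOf-surjective i with proj₁ noEmptyLines i
    ... | j , nonEmpty with covers (i , j) nonEmpty
    ...   | t , vt≡ij = columnIndex t , trans (columnOf-columnIndex t) (cong proj₁ vt≡ij)

    rowOf-surjective : StrictlySurjective _≡_ rowOf
    rowOf-surjective j with proj₂ noEmptyLines j
    ... | i , nonEmpty with covers (i , j) nonEmpty
    ...   | t , vt≡ij = rowIndex t , trans (rowOf-rowIndex t) (cong proj₂ vt≡ij)

    staircaseEntry : ∀ a b → M (columnOf a) (rowOf b) ≡ staircase vertexLabel (toℕ a) (toℕ b)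
    staircaseEntry a b = byCell (onStaircase? (toℕ a) (toℕ b))
      where
      byCell : Dec (OnStaircase (toℕ a) (toℕ b)) →
               M (columnOf a) (rowOf b) ≡ staircase vertexLabel (toℕ a) (toℕ b)
      byCell (yes on) = trans (cong₂ M sameCol sameRow) (sym (staircase-on vertexLabel on))
        where
        t≤k = halves-≤ k (≤-pred (toℕ<n a)) (≤-pred (toℕ<n b))
        sameCol : columnOf a ≡ col (toℕ a + toℕ b)
        sameCol = columnsAgree (columnOf-≤ a) t≤k
                    (trans (⌈columnVertex/2⌉ (toℕ a)) (sym (proj₁ (onStaircase-halves on))))
        sameRow : rowOf b ≡ row (toℕ a + toℕ b)
        sameRow = rowsAgree (rowOf-≤ b) t≤k
                    (trans (sym (n≡⌊n+n/2⌋ (toℕ b))) (sym (proj₂ (onStaircase-halves on))))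
      byCell (no off) with isEmpty? (M (columnOf a) (rowOf b))
      ... | yes empty = trans empty (sym (staircase-off vertexLabel off))
      ... | no nonEmpty with covers (columnOf a , rowOf b) nonEmpty
      ...   | t , vt≡ab = ⊥-elim (off (subst₂ OnStaircase ceiling floor (halves-onStaircase (toℕ t))))
        where
        ceiling : ⌈ toℕ t /2⌉ ≡ toℕ a
        ceiling = trans (sym (toℕ-fromℕ< _))
                        (cong toℕ (columnOf-injective (trans (columnOf-columnIndex t) (cong proj₁ vt≡ab))))
        floor : ⌊ toℕ t /2⌋ ≡ toℕ b
        floor = trans (sym (toℕ-fromℕ< _))
                      (cong toℕ (rowOf-injective (trans (rowOf-rowIndex t) (cong proj₂ vt≡ab))))

    permutedStaircase :
      (∀ t → (toℕ t ≡ 0 ⊎ toℕ t ≡ k) → IsEndLabel (lab M (v t))) →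
      (∀ t → toℕ t ≢ 0 → toℕ t ≢ k → IsInternalLabel (lab M (v t))) →
      PermutedStaircase M k
    permutedStaircase endLabel internalLabel = record
      { columnOrder = permutationOf columnOf columnOf-injective columnOf-surjective
      ; rowOrder    = permutationOf rowOf rowOf-injective rowOf-surjective
      ; label       = vertexLabel
      ; labelling   = record
        { start    = endLabel F.zero (inj₁ refl)
        ; finish   = endLabel (clamp k k) (inj₂ (toℕ-clamp k ≤-refl))
        ; internal = λ {t} 0<t t<k →
            internalLabel (clamp k t) (λ eq → >⇒≢ 0<t (trans (sym (toℕ-clamp k (<⇒≤ t<k))) eq))
                                      (λ eq → <⇒≢ t<k (trans (sym (toℕ-clamp k (<⇒≤ t<k))) eq))
        }
      ; entry       = staircaseEntry
      }

transpose : ∀ {m n} → Matrix m n → Matrix n m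
transpose = applyGM ginverse

module _ {m n} (M : Matrix m n) where

  private
    nonEmpty-inv : ∀ {x} → x ≢ ∅ → inv x ≢ ∅
    nonEmpty-inv {x} x≢∅ = x≢∅ ∘ trans (sym (inv≗id x))

    nonEmpty-uninv : ∀ {x} → inv x ≢ ∅ → x ≢ ∅
    nonEmpty-uninv {x} invx≢∅ = invx≢∅ ∘ trans (inv≗id x)

    empty-inv : ∀ {x} → x ≡ ∅ → inv x ≡ ∅
    empty-inv {x} = trans (inv≗id x)

    empty-uninv : ∀ {x} → inv x ≡ ∅ → x ≡ ∅
    empty-uninv {x} = trans (sym (inv≗id x))

  transpose-noEmptyLines : NoEmptyLines M → NoEmptyLines (transpose M)
  transpose-noEmptyLines (columns , rows) =
    (λ j → proj₁ (rows j) , nonEmpty-inv (proj₂ (rows j))) ,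
    (λ i → proj₁ (columns i) , nonEmpty-inv (proj₂ (columns i)))

  transpose-atMostTwo : AtMostTwoPerLine M → AtMostTwoPerLine (transpose M)
  transpose-atMostTwo (columns , rows) =
    (λ j a b c a<b b<c x y z → rows j a b c a<b b<c (nonEmpty-uninv x) (nonEmpty-uninv y) (nonEmpty-uninv z)) ,
    (λ i a b c a<b b<c x y z → columns i a b c a<b b<c (nonEmpty-uninv x) (nonEmpty-uninv y) (nonEmpty-uninv z))

  transpose-adjacent : ∀ c d → Adjacent M c d → Adjacent (transpose M) (swap c) (swap d)
  transpose-adjacent c d (x , y , inj₁ (same , differ , between)) =
    nonEmpty-inv x , nonEmpty-inv y , inj₂ (same , differ , λ z w → empty-inv (between z w))
  transpose-adjacent c d (x , y , inj₂ (same , differ , between)) =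
    nonEmpty-inv x , nonEmpty-inv y , inj₁ (same , differ , λ z w → empty-inv (between z w))

  untranspose-adjacent : ∀ c d → Adjacent (transpose M) (swap c) (swap d) → Adjacent M c d
  untranspose-adjacent c d (x , y , inj₁ (same , differ , between)) =
    nonEmpty-uninv x , nonEmpty-uninv y , inj₂ (same , differ , λ z w → empty-uninv (between z w))
  untranspose-adjacent c d (x , y , inj₂ (same , differ , between)) =
    nonEmpty-uninv x , nonEmpty-uninv y , inj₁ (same , differ , λ z w → empty-uninv (between z w))

  transpose-path : ∀ {k v} → IsPathVia M k v → IsPathVia (transpose M) k (swap ∘ v)
  transpose-path {v = v} (injective , nonEmpty , covers , adjacency) =
    injective ∘ cong swap ,
    nonEmpty-inv ∘ nonEmpty ,
    (λ c c≢∅ → let (t , vt≡c) = covers (swap c) (nonEmpty-uninv c≢∅) in t , cong swap vt≡c) ,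
    λ s t → proj₁ (adjacency s t) ∘ untranspose-adjacent (v s) (v t) ,
            transpose-adjacent (v s) (v t) ∘ proj₂ (adjacency s t)

  transpose-labelledPath : ∀ {k} → LabelledPath M k → LabelledPath (transpose M) k
  transpose-labelledPath (v , path , endLabel , internalLabel) =
    swap ∘ v , transpose-path path ,
    (λ t eq → subst IsEndLabel (sym (inv≗id _)) (endLabel t eq)) ,
    (λ t ≢0 ≢k → subst IsInternalLabel (sym (inv≗id _)) (internalLabel t ≢0 ≢k))

labelledPath-permutedStaircase : ∀ {m n} {M : Matrix m n} {k} → 1 ≤ k →
  NoEmptyLines M → AtMostTwoPerLine M → LabelledPath M k →
  PermutedStaircase M k ⊎ PermutedStaircase (transpose M) k
labelledPath-permutedStaircase {M = M} 1≤k noEmptyLines atMostTwo labelled@(_ , path , endLabel , internalLabel)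
  with PathMatrix.step noEmptyLines atMostTwo path 0 1≤k
... | inj₂ firstRow =
  inj₁ (PathMatrix.Horizontal.permutedStaircase noEmptyLines atMostTwo path firstRow endLabel internalLabel)
... | inj₁ firstColumn =
  let (_ , pathᵀ , endLabelᵀ , internalLabelᵀ) = transpose-labelledPath M labelled in
  inj₂ (PathMatrix.Horizontal.permutedStaircase (transpose-noEmptyLines M noEmptyLines)
          (transpose-atMostTwo M atMostTwo) pathᵀ firstColumn endLabelᵀ internalLabelᵀ)

-- Staircase layouts of ℕ-indexed matrices

record Permutes (n : ℕ) (f : ℕ → ℕ) : Set where
  field
    range      : ∀ {a} → a < n → f a < n
    injective  : ∀ {a b} → a < n → b < n → f a ≡ f b → a ≡ b
    surjective : ∀ {y} → y < n → ∃ λ a → a < n × f a ≡ y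

module _ {n f} (P : Permutes n f) where

  open Permutes P

  toPermutation : Permutation′ n
  toPermutation = permutationOf (λ a → fromℕ< (range (toℕ<n a)))
    (λ {a} {b} eq → toℕ-injective (injective (toℕ<n a) (toℕ<n b)
                      (trans (sym (toℕ-fromℕ< _)) (trans (cong toℕ eq) (toℕ-fromℕ< _)))))
    (λ y → let (a , a<n , fa≡y) = surjective (toℕ<n y) in
           fromℕ< a<n , toℕ-injective (trans (toℕ-fromℕ< _) (trans (cong f (toℕ-fromℕ< a<n)) fa≡y)))

  toℕ-toPermutation : ∀ a → toℕ (toPermutation ⟨$⟩ʳ a) ≡ f (toℕ a)
  toℕ-toPermutation a = toℕ-fromℕ< _

permutes-id : ∀ n → Permutes n id
permutes-id n = record { range = id ; injective = λ _ _ eq → eq ; surjective = λ {y} y<n → y , y<n , refl }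

shiftFrom : ℕ → ℕ → ℕ
shiftFrom p x with x <? p
... | yes _ = x
... | no  _ = suc x

shiftFrom-< : ∀ {p x} → x < p → shiftFrom p x ≡ x
shiftFrom-< {p} {x} x<p with x <? p
... | yes _   = refl
... | no  x≮p = ⊥-elim (x≮p x<p)

shiftFrom-≥ : ∀ {p x} → p ≤ x → shiftFrom p x ≡ suc x
shiftFrom-≥ {p} {x} p≤x with x <? p
... | yes x<p = ⊥-elim (<⇒≱ x<p p≤x)
... | no  _   = refl

shiftFrom-≢ : ∀ p x → shiftFrom p x ≢ p
shiftFrom-≢ p x with x <? p
... | yes x<p = <⇒≢ x<p
... | no  x≮p = λ 1+x≡p → x≮p (≤-reflexive 1+x≡p)

shiftFrom-injective : ∀ p {x y} → shiftFrom p x ≡ shiftFrom p y → x ≡ y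
shiftFrom-injective p {x} {y} eq with x <? p | y <? p
... | yes _   | yes _   = eq
... | yes x<p | no  y≮p = ⊥-elim (y≮p (<-trans (n<1+n y) (subst (_< p) eq x<p)))
... | no  x≮p | yes y<p = ⊥-elim (x≮p (<-trans (n<1+n x) (subst (_< p) (sym eq) y<p)))
... | no  _   | no  _   = suc-injective eq

shiftFrom-range : ∀ p {n x} → x < n → shiftFrom p x < suc n
shiftFrom-range p {x = x} x<n with x <? p
... | yes _ = m<n⇒m<1+n x<n
... | no  _ = s≤s x<n

shiftFrom-hits : ∀ {p n y} → p ≤ n → y < suc n → y ≢ p → ∃ λ x → x < n × shiftFrom p x ≡ y
shiftFrom-hits {p} {n} {y} p≤n y<1+n y≢p with y <? p
... | yes y<p = y , <-≤-trans y<p p≤n , shiftFrom-< y<p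
... | no  y≮p with y | ≤∧≢⇒< (≮⇒≥ y≮p) (y≢p ∘ sym)
...   | suc x | p≤x = x , ≤-pred y<1+n , shiftFrom-≥ (≤-pred p≤x)

insertAt : ℕ → ℕ → (ℕ → ℕ) → ℕ → ℕ
insertAt n p f a with a ≟ n
... | yes _ = p
... | no  _ = shiftFrom p (f a)

insertAt-new : ∀ {n p f a} → a ≡ n → insertAt n p f a ≡ p
insertAt-new {n} {a = a} a≡n with a ≟ n
... | yes _   = refl
... | no  a≢n = ⊥-elim (a≢n a≡n)

insertAt-old : ∀ {n p f a} → a ≢ n → insertAt n p f a ≡ shiftFrom p (f a)
insertAt-old {n} {a = a} a≢n with a ≟ n
... | yes a≡n = ⊥-elim (a≢n a≡n)
... | no  _   = refl

permutes-insert : ∀ {n p f} → p ≤ n → Permutes n f → Permutes (suc n) (insertAt n p f)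
permutes-insert {n} {p} {f} p≤n P = record { range = range′ ; injective = injective′ ; surjective = surjective′ }
  where
  open Permutes P

  old< : ∀ {a} → a < suc n → a ≢ n → a < n
  old< a<1+n a≢n = ≤∧≢⇒< (≤-pred a<1+n) a≢n

  range′ : ∀ {a} → a < suc n → insertAt n p f a < suc n
  range′ {a} a<1+n with a ≟ n
  ... | yes _   = s≤s p≤n
  ... | no  a≢n = shiftFrom-range p (range (old< a<1+n a≢n))

  injective′ : ∀ {a b} → a < suc n → b < suc n → insertAt n p f a ≡ insertAt n p f b → a ≡ b
  injective′ {a} {b} a<1+n b<1+n eq with a ≟ n | b ≟ n
  ... | yes a≡n | yes b≡n = trans a≡n (sym b≡n)
  ... | yes _   | no  _   = ⊥-elim (shiftFrom-≢ p _ (sym eq))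
  ... | no  _   | yes _   = ⊥-elim (shiftFrom-≢ p _ eq)
  ... | no  a≢n | no  b≢n = injective (old< a<1+n a≢n) (old< b<1+n b≢n) (shiftFrom-injective p eq)

  surjective′ : ∀ {y} → y < suc n → ∃ λ a → a < suc n × insertAt n p f a ≡ y
  surjective′ {y} y<1+n with y ≟ p
  ... | yes y≡p = n , ≤-refl , trans (insertAt-new {n} {p} {f} refl) (sym y≡p)
  ... | no  y≢p with shiftFrom-hits p≤n y<1+n y≢p
  ...   | x , x<n , shift≡y with surjective x<n
  ...     | a , a<n , fa≡x =
    a , m<n⇒m<1+n a<n , trans (insertAt-old {n} {p} {f} (<⇒≢ a<n)) (trans (cong (shiftFrom p) fa≡x) shift≡y)

extendLabels : (ℕ → Label) → ℕ → Label → Label → ℕ → Label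
extendLabels L k ι ε t with t ≟ k | t ≟ suc k
... | yes _ | _     = ι
... | no  _ | yes _ = ε
... | no  _ | no  _ = L t

module _ {L : ℕ → Label} {k : ℕ} {ι ε : Label} where

  extendLabels-old : ∀ {t} → t < k → extendLabels L k ι ε t ≡ L t
  extendLabels-old {t} t<k with t ≟ k | t ≟ suc k
  ... | yes t≡k | _         = ⊥-elim (<⇒≢ t<k t≡k)
  ... | no  _   | yes t≡1+k = ⊥-elim (<⇒≢ (m<n⇒m<1+n t<k) t≡1+k)
  ... | no  _   | no  _     = refl

  extendLabels-end : extendLabels L k ι ε k ≡ ι
  extendLabels-end with k ≟ k
  ... | yes _   = refl
  ... | no  k≢k = ⊥-elim (k≢k refl)

  extendLabels-new : extendLabels L k ι ε (suc k) ≡ ε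
  extendLabels-new with suc k ≟ k | suc k ≟ suc k
  ... | yes 1+k≡k | _             = ⊥-elim (1+n≢n 1+k≡k)
  ... | no  _     | yes _         = refl
  ... | no  _     | no  1+k≢1+k   = ⊥-elim (1+k≢1+k refl)

  extendLabelling : 0 < k → PathLabelling L k → IsInternalLabel ι → IsEndLabel ε →
                    PathLabelling (extendLabels L k ι ε) (suc k)
  extendLabelling 0<k P internalι endε = record
    { start    = subst IsEndLabel (sym (extendLabels-old 0<k)) (PathLabelling.start P)
    ; finish   = subst IsEndLabel (sym extendLabels-new) endε
    ; internal = internal′
    }
    where
    internal′ : ∀ {t} → 0 < t → t < suc k → IsInternalLabel (extendLabels L k ι ε t)
    internal′ {t} 0<t t<1+k with m≤n⇒m<n∨m≡n (≤-pred t<1+k)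
    ... | inj₁ t<k = subst IsInternalLabel (sym (extendLabels-old t<k)) (PathLabelling.internal P 0<t t<k)
    ... | inj₂ refl = subst IsInternalLabel (sym extendLabels-end) internalι

  staircase-extendLabels : ∀ a b → a + b < k → staircase (extendLabels L k ι ε) a b ≡ staircase L a b
  staircase-extendLabels a b a+b<k with onStaircase? a b
  ... | yes _ = extendLabels-old a+b<k
  ... | no  _ = refl

record StaircaseLayout (E : ℕ → ℕ → Label) (k x₀ y₀ : ℕ) : Set where
  field
    col row      : ℕ → ℕ
    col-permutes : Permutes (suc ⌈ k /2⌉) col
    row-permutes : Permutes (suc ⌊ k /2⌋) row
    label        : ℕ → Label
    labelling    : PathLabelling label k
    entry        : ∀ {a b} → a ≤ ⌈ k /2⌉ → b ≤ ⌊ k /2⌋ → E (col a) (row b) ≡ staircase label a b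
    endColumn    : col ⌈ k /2⌉ ≡ x₀
    endRow       : row ⌊ k /2⌋ ≡ y₀

layout⇒permutedStaircase : ∀ {E k x₀ y₀ m n} → StaircaseLayout E k x₀ y₀ →
  m ≡ suc ⌈ k /2⌉ → n ≡ suc ⌊ k /2⌋ → PermutedStaircase {m} {n} (λ i j → E (toℕ i) (toℕ j)) k
layout⇒permutedStaircase {E} S refl refl = record
  { columnOrder = toPermutation col-permutes
  ; rowOrder    = toPermutation row-permutes
  ; label       = label
  ; labelling   = labelling
  ; entry       = λ a b → trans (cong₂ E (toℕ-toPermutation col-permutes a) (toℕ-toPermutation row-permutes b))
                                (entry (≤-pred (toℕ<n a)) (≤-pred (toℕ<n b)))
  }
  where open StaircaseLayout S

module LayoutShape {E k x₀ y₀} (S : StaircaseLayout E k x₀ y₀) {c r : ℕ}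
                   (⌈k/2⌉≡c : ⌈ k /2⌉ ≡ c) (⌊k/2⌋≡r : ⌊ k /2⌋ ≡ r) where

  open StaircaseLayout S

  col-perm : Permutes (suc c) col
  col-perm = subst (λ c → Permutes (suc c) col) ⌈k/2⌉≡c col-permutes

  row-perm : Permutes (suc r) row
  row-perm = subst (λ r → Permutes (suc r) row) ⌊k/2⌋≡r row-permutes

  entry≤ : ∀ {a b} → a ≤ c → b ≤ r → E (col a) (row b) ≡ staircase label a b
  entry≤ {a} {b} a≤c b≤r = entry (subst (a ≤_) (sym ⌈k/2⌉≡c) a≤c) (subst (b ≤_) (sym ⌊k/2⌋≡r) b≤r)

  col-end : col c ≡ x₀
  col-end = trans (cong col (sym ⌈k/2⌉≡c)) endColumn

  row-end : row r ≡ y₀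
  row-end = trans (cong row (sym ⌊k/2⌋≡r)) endRow

  col-≤ : ∀ {a} → a ≤ c → col a ≤ c
  col-≤ a≤c = ≤-pred (Permutes.range col-perm (s≤s a≤c))

  row-≤ : ∀ {b} → b ≤ r → row b ≤ r
  row-≤ b≤r = ≤-pred (Permutes.range row-perm (s≤s b≤r))

  col≢x₀ : ∀ {a} → a ≤ c → a ≢ c → col a ≢ x₀
  col≢x₀ a≤c a≢c eq = a≢c (Permutes.injective col-perm (s≤s a≤c) ≤-refl (trans eq (sym col-end)))

  row≢y₀ : ∀ {b} → b ≤ r → b ≢ r → row b ≢ y₀
  row≢y₀ b≤r b≢r eq = b≢r (Permutes.injective row-perm (s≤s b≤r) ≤-refl (trans eq (sym row-end)))

-- E′ arises from E by inserting a column at p that holds the new end of the path in the row y₀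
-- of the old end (x₀ , y₀); the other cells of that row and column are empty.
record ColumnAppended (E E′ : ℕ → ℕ → Label) (c r x₀ y₀ p : ℕ) : Set where
  field
    kept           : ∀ {x y} → x ≤ c → y ≤ r → y ≢ y₀ → E′ (shiftFrom p x) y ≡ E x y
    oldEnd         : IsInternalLabel (E′ (shiftFrom p x₀) y₀)
    endRowEmpty    : ∀ {x} → x ≤ c → x ≢ x₀ → E′ (shiftFrom p x) y₀ ≡ ∅
    newEnd         : IsEndLabel (E′ p y₀)
    newColumnEmpty : ∀ {y} → y ≤ r → y ≢ y₀ → E′ p y ≡ ∅

appendColumn : ∀ {E E′ N x₀ y₀ p} → 0 < N → p ≤ suc N →
  StaircaseLayout E (N + N) x₀ y₀ → ColumnAppended E E′ N N x₀ y₀ p →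
  StaircaseLayout E′ (suc (N + N)) p y₀
appendColumn {E} {E′} {N} {x₀} {y₀} {p} 0<N p≤1+N S A = record
  { col          = col′
  ; row          = row
  ; col-permutes = subst (λ c → Permutes (suc (suc c)) col′) (n≡⌊n+n/2⌋ N) (permutes-insert p≤1+N col-perm)
  ; row-permutes = subst (λ r → Permutes (suc r) row) (n≡⌈n+n/2⌉ N) row-perm
  ; label        = label′
  ; labelling    = extendLabelling (≤-trans 0<N (m≤m+n N N)) labelling oldEnd newEnd
  ; entry        = λ {a} {b} a≤ b≤ → entry′ (subst (a ≤_) (cong suc (sym (n≡⌊n+n/2⌋ N))) a≤)
                                             (subst (b ≤_) (sym (n≡⌈n+n/2⌉ N)) b≤)
  ; endColumn    = insertAt-new (cong suc (sym (n≡⌊n+n/2⌋ N)))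
  ; endRow       = trans (cong row (sym (n≡⌈n+n/2⌉ N))) row-end
  }
  where
  open StaircaseLayout S
  open LayoutShape S (sym (n≡⌈n+n/2⌉ N)) (sym (n≡⌊n+n/2⌋ N))
  open ColumnAppended A

  col′ : ℕ → ℕ
  col′ = insertAt (suc N) p col

  ι ε : Label
  ι = E′ (shiftFrom p x₀) y₀
  ε = E′ p y₀

  label′ : ℕ → Label
  label′ = extendLabels label (N + N) ι ε

  entry′ : ∀ {a b} → a ≤ suc N → b ≤ N → E′ (col′ a) (row b) ≡ staircase label′ a b
  entry′ {a} {b} a≤1+N b≤N = byCell (a ≟ suc N) (b ≟ N) (a ≟ N)
    where
    open ≡-Reasoning
    byCell : Dec (a ≡ suc N) → Dec (b ≡ N) → Dec (a ≡ N) → E′ (col′ a) (row b) ≡ staircase label′ a b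
    byCell (yes a≡1+N) (yes b≡N) _ = begin
      E′ (col′ a) (row b)  ≡⟨ cong₂ E′ (insertAt-new a≡1+N) (trans (cong row b≡N) row-end) ⟩
      ε                    ≡⟨ sym (extendLabels-new {label} {N + N} {ι} {ε}) ⟩
      label′ (suc N + N)   ≡⟨ cong label′ (sym (cong₂ _+_ a≡1+N b≡N)) ⟩
      label′ (a + b)       ≡⟨ sym (staircase-on label′ (inj₂ (trans a≡1+N (cong suc (sym b≡N))))) ⟩
      staircase label′ a b ∎
    byCell (yes a≡1+N) (no b≢N) _ = begin
      E′ (col′ a) (row b)  ≡⟨ cong (λ x → E′ x (row b)) (insertAt-new a≡1+N) ⟩
      E′ p (row b)         ≡⟨ newColumnEmpty (row-≤ b≤N) (row≢y₀ b≤N b≢N) ⟩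
      ∅                    ≡⟨ sym (staircase-off label′ off) ⟩
      staircase label′ a b ∎
      where
      off : ¬ OnStaircase a b
      off (inj₁ a≡b)   = <⇒≢ (s≤s b≤N) (trans (sym a≡b) a≡1+N)
      off (inj₂ a≡1+b) = b≢N (suc-injective (trans (sym a≡1+b) a≡1+N))
    byCell (no a≢1+N) (yes b≡N) (yes a≡N) = begin
      E′ (col′ a) (row b)          ≡⟨ cong₂ E′ (insertAt-old a≢1+N) (trans (cong row b≡N) row-end) ⟩
      E′ (shiftFrom p (col a)) y₀  ≡⟨ cong (λ x → E′ (shiftFrom p x) y₀) (trans (cong col a≡N) col-end) ⟩
      ι                            ≡⟨ sym (extendLabels-end {label} {N + N} {ι} {ε}) ⟩
      label′ (N + N)               ≡⟨ cong label′ (sym (cong₂ _+_ a≡N b≡N)) ⟩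
      label′ (a + b)               ≡⟨ sym (staircase-on label′ (inj₁ (trans a≡N (sym b≡N)))) ⟩
      staircase label′ a b         ∎
    byCell (no a≢1+N) (yes b≡N) (no a≢N) = begin
      E′ (col′ a) (row b)          ≡⟨ cong₂ E′ (insertAt-old a≢1+N) (trans (cong row b≡N) row-end) ⟩
      E′ (shiftFrom p (col a)) y₀  ≡⟨ endRowEmpty (col-≤ a≤N) (col≢x₀ a≤N a≢N) ⟩
      ∅                            ≡⟨ sym (staircase-off label′ off) ⟩
      staircase label′ a b         ∎
      where
      a≤N = ≤-pred (≤∧≢⇒< a≤1+N a≢1+N)
      off : ¬ OnStaircase a b
      off (inj₁ a≡b)   = a≢N (trans a≡b b≡N)
      off (inj₂ a≡1+b) = a≢1+N (trans a≡1+b (cong suc b≡N))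
    byCell (no a≢1+N) (no b≢N) _ = begin
      E′ (col′ a) (row b)               ≡⟨ cong (λ x → E′ x (row b)) (insertAt-old a≢1+N) ⟩
      E′ (shiftFrom p (col a)) (row b)  ≡⟨ kept (col-≤ a≤N) (row-≤ b≤N) (row≢y₀ b≤N b≢N) ⟩
      E (col a) (row b)                 ≡⟨ entry≤ a≤N b≤N ⟩
      staircase label a b               ≡⟨ sym (staircase-extendLabels {label} {N + N} {ι} {ε} a b
                                                 (+-mono-≤-< a≤N (≤∧≢⇒< b≤N b≢N))) ⟩
      staircase label′ a b              ∎
      where
      a≤N = ≤-pred (≤∧≢⇒< a≤1+N a≢1+N)

record RowAppended (E E′ : ℕ → ℕ → Label) (c r x₀ y₀ p : ℕ) : Set where
  field
    kept           : ∀ {x y} → x ≤ c → y ≤ r → x ≢ x₀ → E′ x (shiftFrom p y) ≡ E x y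
    oldEnd         : IsInternalLabel (E′ x₀ (shiftFrom p y₀))
    endColumnEmpty : ∀ {y} → y ≤ r → y ≢ y₀ → E′ x₀ (shiftFrom p y) ≡ ∅
    newEnd         : IsEndLabel (E′ x₀ p)
    newRowEmpty    : ∀ {x} → x ≤ c → x ≢ x₀ → E′ x p ≡ ∅

appendRow : ∀ {E E′ N x₀ y₀ p} → p ≤ suc N →
  StaircaseLayout E (suc (N + N)) x₀ y₀ → RowAppended E E′ (suc N) N x₀ y₀ p →
  StaircaseLayout E′ (suc (suc (N + N))) x₀ p
appendRow {E} {E′} {N} {x₀} {y₀} {p} p≤1+N S A = record
  { col          = col
  ; row          = row′
  ; col-permutes = subst (λ c → Permutes (suc (suc c)) col) (n≡⌈n+n/2⌉ N) col-perm
  ; row-permutes = subst (λ r → Permutes (suc (suc r)) row′) (n≡⌊n+n/2⌋ N) (permutes-insert p≤1+N row-perm)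
  ; label        = label′
  ; labelling    = extendLabelling (s≤s z≤n) labelling oldEnd newEnd
  ; entry        = λ {a} {b} a≤ b≤ → entry′ (subst (a ≤_) (cong suc (sym (n≡⌈n+n/2⌉ N))) a≤)
                                             (subst (b ≤_) (cong suc (sym (n≡⌊n+n/2⌋ N))) b≤)
  ; endColumn    = trans (cong col (cong suc (sym (n≡⌈n+n/2⌉ N)))) col-end
  ; endRow       = insertAt-new (cong suc (sym (n≡⌊n+n/2⌋ N)))
  }
  where
  open StaircaseLayout S
  open LayoutShape S (cong suc (sym (n≡⌊n+n/2⌋ N))) (sym (n≡⌈n+n/2⌉ N))
  open RowAppended A

  row′ : ℕ → ℕ
  row′ = insertAt (suc N) p row

  ι ε : Label
  ι = E′ x₀ (shiftFrom p y₀)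
  ε = E′ x₀ p

  label′ : ℕ → Label
  label′ = extendLabels label (suc (N + N)) ι ε

  entry′ : ∀ {a b} → a ≤ suc N → b ≤ suc N → E′ (col a) (row′ b) ≡ staircase label′ a b
  entry′ {a} {b} a≤1+N b≤1+N = byCell (b ≟ suc N) (a ≟ suc N) (b ≟ N)
    where
    open ≡-Reasoning
    byCell : Dec (b ≡ suc N) → Dec (a ≡ suc N) → Dec (b ≡ N) → E′ (col a) (row′ b) ≡ staircase label′ a b
    byCell (yes b≡1+N) (yes a≡1+N) _ = begin
      E′ (col a) (row′ b)        ≡⟨ cong₂ E′ (trans (cong col a≡1+N) col-end) (insertAt-new b≡1+N) ⟩
      ε                          ≡⟨ sym (extendLabels-new {label} {suc (N + N)} {ι} {ε}) ⟩
      label′ (suc (suc (N + N))) ≡⟨ cong label′ (sym (trans (cong₂ _+_ a≡1+N b≡1+N)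
                                                          (cong suc (+-suc N N)))) ⟩
      label′ (a + b)             ≡⟨ sym (staircase-on label′ (inj₁ (trans a≡1+N (sym b≡1+N)))) ⟩
      staircase label′ a b       ∎
    byCell (yes b≡1+N) (no a≢1+N) _ = begin
      E′ (col a) (row′ b)        ≡⟨ cong (E′ (col a)) (insertAt-new b≡1+N) ⟩
      E′ (col a) p               ≡⟨ newRowEmpty (col-≤ a≤1+N) (col≢x₀ a≤1+N a≢1+N) ⟩
      ∅                          ≡⟨ sym (staircase-off label′ off) ⟩
      staircase label′ a b       ∎
      where
      off : ¬ OnStaircase a b
      off (inj₁ a≡b)   = a≢1+N (trans a≡b b≡1+N)
      off (inj₂ a≡1+b) = <⇒≢ (s≤s a≤1+N) (trans a≡1+b (cong suc b≡1+N))
    byCell (no b≢1+N) (yes a≡1+N) (yes b≡N) = begin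
      E′ (col a) (row′ b)             ≡⟨ cong₂ E′ (trans (cong col a≡1+N) col-end) (insertAt-old b≢1+N) ⟩
      E′ x₀ (shiftFrom p (row b))     ≡⟨ cong (E′ x₀ ∘ shiftFrom p) (trans (cong row b≡N) row-end) ⟩
      ι                               ≡⟨ sym (extendLabels-end {label} {suc (N + N)} {ι} {ε}) ⟩
      label′ (suc N + N)              ≡⟨ cong label′ (sym (cong₂ _+_ a≡1+N b≡N)) ⟩
      label′ (a + b)                  ≡⟨ sym (staircase-on label′ (inj₂ (trans a≡1+N (cong suc (sym b≡N))))) ⟩
      staircase label′ a b            ∎
    byCell (no b≢1+N) (yes a≡1+N) (no b≢N) = begin
      E′ (col a) (row′ b)             ≡⟨ cong₂ E′ (trans (cong col a≡1+N) col-end) (insertAt-old b≢1+N) ⟩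
      E′ x₀ (shiftFrom p (row b))     ≡⟨ endColumnEmpty (row-≤ b≤N) (row≢y₀ b≤N b≢N) ⟩
      ∅                               ≡⟨ sym (staircase-off label′ off) ⟩
      staircase label′ a b            ∎
      where
      b≤N = ≤-pred (≤∧≢⇒< b≤1+N b≢1+N)
      off : ¬ OnStaircase a b
      off (inj₁ a≡b)   = b≢1+N (trans (sym a≡b) a≡1+N)
      off (inj₂ a≡1+b) = b≢N (suc-injective (trans (sym a≡1+b) a≡1+N))
    byCell (no b≢1+N) (no a≢1+N) _ = begin
      E′ (col a) (row′ b)              ≡⟨ cong (E′ (col a)) (insertAt-old b≢1+N) ⟩
      E′ (col a) (shiftFrom p (row b)) ≡⟨ kept (col-≤ a≤1+N) (row-≤ b≤N) (col≢x₀ a≤1+N a≢1+N) ⟩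
      E (col a) (row b)                ≡⟨ entry≤ a≤1+N b≤N ⟩
      staircase label a b              ≡⟨ sym (staircase-extendLabels {label} {suc (N + N)} {ι} {ε} a b
                                                (s≤s (+-mono-≤ a≤N b≤N))) ⟩
      staircase label′ a b             ∎
      where
      a≤N = ≤-pred (≤∧≢⇒< a≤1+N a≢1+N)
      b≤N = ≤-pred (≤∧≢⇒< b≤1+N b≢1+N)

-- The matrices M^k

if-true : ∀ {A : Set} b {x y : A} → b ≡ true → (if b then x else y) ≡ x
if-true _ refl = refl

if-false : ∀ {A : Set} b {x y : A} → b ≡ false → (if b then x else y) ≡ y
if-false _ refl = refl

≤ᵇ-true : ∀ {m n} → m ≤ n → (m ≤ᵇ n) ≡ true
≤ᵇ-true m≤n = Equivalence.to T-≡ (≤⇒≤ᵇ m≤n)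

≤ᵇ-false : ∀ {m n} → n < m → (m ≤ᵇ n) ≡ false
≤ᵇ-false {m} {n} n<m with m ≤ᵇ n in eq
... | false = refl
... | true  = ⊥-elim (<⇒≱ n<m (≤ᵇ⇒≤ m n (subst T (sym eq) _)))

≡ᵇ-true : ∀ m n → m ≡ n → (m ≡ᵇ n) ≡ true
≡ᵇ-true m n m≡n = Equivalence.to T-≡ (≡⇒≡ᵇ m n m≡n)

≡ᵇ-false : ∀ m n → m ≢ n → (m ≡ᵇ n) ≡ false
≡ᵇ-false m n m≢n with m ≡ᵇ n in eq
... | false = refl
... | true  = ⊥-elim (m≢n (≡ᵇ⇒≡ m n (subst T (sym eq) _)))

-- The range test inR of Defs, which is private there.
inside : ℕ → ℕ → ℕ → Bool
inside a b x = (a ≤ᵇ x) ∧ (x ≤ᵇ b)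

inside-true : ∀ a b x → a ≤ x → x ≤ b → inside a b x ≡ true
inside-true a b x a≤x x≤b = cong₂ _∧_ (≤ᵇ-true a≤x) (≤ᵇ-true x≤b)

inside-above : ∀ a b x → b < x → inside a b x ≡ false
inside-above a b x b<x = trans (cong ((a ≤ᵇ x) ∧_) (≤ᵇ-false b<x)) (∧-zeroʳ (a ≤ᵇ x))

∧-falseˡ : ∀ a b → a ≡ false → (a ∧ b) ≡ false
∧-falseˡ a b refl = refl

∧-falseʳ : ∀ a b → b ≡ false → (a ∧ b) ≡ false
∧-falseʳ a b refl = ∧-zeroʳ a

suc≤+1 : ∀ m {x} → x ≤ m → suc x ≤ m + 1
suc≤+1 m {x} x≤m = subst (suc x ≤_) (+-comm 1 m) (s≤s x≤m)

+1<2+ : ∀ m → m + 1 < suc (suc m)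
+1<2+ m = s≤s (≤-reflexive (+-comm m 1))

2+≡+2 : ∀ m → suc (suc m) ≡ m + 2
2+≡+2 m = +-comm 2 m

1<+2 : ∀ m → 1 < m + 2
1<+2 m = m≤n+m 2 m

+1<+2 : ∀ m → m + 1 < m + 2
+1<+2 m = ≤-reflexive (sym (+-suc m 1))

module _ (ℓ : ℕ) where
  private
    n = 2 * ℓ
    A = 2 * ℓ + 1
    B = 2 * ℓ + 2

  mk2-copy : ∀ {x y} → x ≤ n → y ≤ n → mk2 ℓ (suc x) (suc y) ≡ mk1 ℓ (suc x) (suc y)
  mk2-copy {x} {y} x≤n y≤n =
    if-true (inside 1 A (suc x) ∧ inside 1 A (suc y))
            (cong₂ _∧_ (inside-true 1 A (suc x) (s≤s z≤n) (suc≤+1 n x≤n))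
                       (inside-true 1 A (suc y) (s≤s z≤n) (suc≤+1 n y≤n)))

  mk2-oldEnd : mk2 ℓ (suc (suc n)) 1 ≡ av12
  mk2-oldEnd =
    trans (if-false (inside 1 A (suc (suc n)) ∧ inside 1 A 1)
                    (∧-falseˡ _ _ (inside-above 1 A (suc (suc n)) (+1<2+ n))))
    (trans (if-false ((suc (suc n) ≡ᵇ B) ∧ (1 ≡ᵇ B)) (∧-falseʳ _ _ (≡ᵇ-false 1 B (<⇒≢ (1<+2 n)))))
           (if-true ((suc (suc n) ≡ᵇ B) ∧ (1 ≡ᵇ 1)) (cong (_∧ true) (≡ᵇ-true _ B (2+≡+2 n)))))

  mk2-endColumnEmpty : ∀ {y} → 0 < y → y ≤ n → mk2 ℓ (suc (suc n)) (suc y) ≡ ∅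
  mk2-endColumnEmpty {y} 0<y y≤n =
    trans (if-false (inside 1 A (suc (suc n)) ∧ inside 1 A (suc y))
                    (∧-falseˡ _ _ (inside-above 1 A (suc (suc n)) (+1<2+ n))))
    (trans (if-false ((suc (suc n) ≡ᵇ B) ∧ (suc y ≡ᵇ B))
                     (∧-falseʳ _ _ (≡ᵇ-false (suc y) B (<⇒≢ (<-≤-trans (s≤s (suc≤+1 n y≤n)) (+1<+2 n))))))
           (if-false ((suc (suc n) ≡ᵇ B) ∧ (suc y ≡ᵇ 1))
                     (∧-falseʳ _ _ (≡ᵇ-false (suc y) 1 (>⇒≢ (s≤s 0<y))))))

  mk2-newEnd : mk2 ℓ (suc (suc n)) (suc (suc n)) ≡ ⊕21
  mk2-newEnd =
    trans (if-false (inside 1 A (suc (suc n)) ∧ inside 1 A (suc (suc n)))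
                    (∧-falseˡ _ _ (inside-above 1 A (suc (suc n)) (+1<2+ n))))
          (if-true ((suc (suc n) ≡ᵇ B) ∧ (suc (suc n) ≡ᵇ B))
                   (cong₂ _∧_ (≡ᵇ-true _ B (2+≡+2 n)) (≡ᵇ-true _ B (2+≡+2 n))))

  mk2-newRowEmpty : ∀ {x} → x ≤ n → mk2 ℓ (suc x) (suc (suc n)) ≡ ∅
  mk2-newRowEmpty {x} x≤n =
    trans (if-false (inside 1 A (suc x) ∧ inside 1 A (suc (suc n)))
                    (∧-falseʳ _ _ (inside-above 1 A (suc (suc n)) (+1<2+ n))))
    (trans (if-false ((suc x ≡ᵇ B) ∧ (suc (suc n) ≡ᵇ B)) (∧-falseˡ _ _ (≡ᵇ-false (suc x) B 1+x≢B)))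
           (if-false ((suc x ≡ᵇ B) ∧ (suc (suc n) ≡ᵇ 1)) (∧-falseˡ _ _ (≡ᵇ-false (suc x) B 1+x≢B))))
    where
    1+x≢B : suc x ≢ B
    1+x≢B = <⇒≢ (<-≤-trans (s≤s (suc≤+1 n x≤n)) (+1<+2 n))

  private
    C = 2 * ℓ + 3

    2+x≤C : ∀ {x} → x ≤ suc n → suc (suc x) ≤ C
    2+x≤C {x} x≤1+n = subst (suc (suc x) ≤_) (+-comm 3 n) (s≤s (s≤s x≤1+n))

  mk3-copy : ∀ {x y} → x ≤ suc n → y ≤ n → mk3 ℓ (suc (suc x)) (suc y) ≡ mk2 ℓ (suc x) (suc y)
  mk3-copy {x} {y} x≤1+n y≤n =
    if-true (inside 2 C (suc (suc x)) ∧ inside 1 A (suc y))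
            (cong₂ _∧_ (inside-true 2 C (suc (suc x)) (s≤s (s≤s z≤n)) (2+x≤C x≤1+n))
                       (inside-true 1 A (suc y) (s≤s z≤n) (suc≤+1 n y≤n)))

  mk3-oldEnd : mk3 ℓ (suc (suc (suc n))) (suc (suc n)) ≡ av21
  mk3-oldEnd =
    trans (if-false (inside 2 C (suc (suc (suc n))) ∧ inside 1 A (suc (suc n)))
                    (∧-falseʳ _ _ (inside-above 1 A (suc (suc n)) (+1<2+ n))))
          (if-true ((suc (suc (suc n)) ≡ᵇ C) ∧ (suc (suc n) ≡ᵇ B))
                   (cong₂ _∧_ (≡ᵇ-true _ C (+-comm 3 n)) (≡ᵇ-true _ B (2+≡+2 n))))

  mk3-endRowEmpty : ∀ {x} → x ≤ n → mk3 ℓ (suc (suc x)) (suc (suc n)) ≡ ∅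
  mk3-endRowEmpty {x} x≤n =
    trans (if-false (inside 2 C (suc (suc x)) ∧ inside 1 A (suc (suc n)))
                    (∧-falseʳ _ _ (inside-above 1 A (suc (suc n)) (+1<2+ n))))
          (if-false ((suc (suc x) ≡ᵇ C) ∧ (suc (suc n) ≡ᵇ B))
                    (∧-falseˡ _ _ (≡ᵇ-false (suc (suc x)) C (<⇒≢ (2+x≤C (s≤s x≤n))))))

  mk3-newEnd : mk3 ℓ 1 (suc (suc n)) ≡ ⊖12
  mk3-newEnd =
    if-true ((1 ≡ᵇ 1) ∧ (suc (suc n) ≡ᵇ B)) (≡ᵇ-true _ B (2+≡+2 n))

  mk3-newColumnEmpty : ∀ {y} → y ≤ n → mk3 ℓ 1 (suc y) ≡ ∅
  mk3-newColumnEmpty {y} y≤n =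
    trans (if-false ((1 ≡ᵇ 1) ∧ (suc y ≡ᵇ B))
                    (≡ᵇ-false (suc y) B (<⇒≢ (<-≤-trans (s≤s (suc≤+1 n y≤n)) (+1<+2 n)))))
          (if-false ((1 ≡ᵇ C) ∧ (suc y ≡ᵇ B)) (∧-falseˡ _ _ (≡ᵇ-false 1 C (<⇒≢ (2+x≤C z≤n)))))

  mk4-copy : ∀ {x y} → 0 < x → x ≤ suc (suc n) → y ≤ suc n →
             mk4 ℓ (suc x) (suc (suc y)) ≡ mk3 ℓ (suc x) (suc y)
  mk4-copy {suc x} {y} _ x≤2+n y≤1+n =
    if-true (inside 2 C (suc (suc x)) ∧ inside 2 C (suc (suc y)))
            (cong₂ _∧_ (inside-true 2 C (suc (suc x)) (s≤s (s≤s z≤n)) (2+x≤C (≤-pred x≤2+n)))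
                       (inside-true 2 C (suc (suc y)) (s≤s (s≤s z≤n)) (2+x≤C y≤1+n)))

  mk4-oldEnd : mk4 ℓ 1 (suc (suc (suc n))) ≡ av12
  mk4-oldEnd =
    if-true ((1 ≡ᵇ 1) ∧ (suc (suc (suc n)) ≡ᵇ C)) (≡ᵇ-true _ C (+-comm 3 n))

  mk4-endColumnEmpty : ∀ {y} → y ≤ n → mk4 ℓ 1 (suc (suc y)) ≡ ∅
  mk4-endColumnEmpty {y} y≤n =
    if-false ((1 ≡ᵇ 1) ∧ (suc (suc y) ≡ᵇ C)) (≡ᵇ-false (suc (suc y)) C (<⇒≢ (2+x≤C (s≤s y≤n))))

  mk4-newEnd : mk4 ℓ 1 1 ≡ ⊕21
  mk4-newEnd = refl

  mk4-newRowEmpty : ∀ {x} → 0 < x → mk4 ℓ (suc x) 1 ≡ ∅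
  mk4-newRowEmpty {suc x} _ =
    if-false (inside 2 C (suc (suc x)) ∧ inside 2 C 1) (∧-falseʳ _ _ refl)

module _ (ℓ′ : ℕ) where
  private
    m = 2 * suc ℓ′

  mk1-copy : ∀ {x y} → x ≤ m → 0 < y → y ≤ m → mk1 (suc ℓ′) (suc x) (suc y) ≡ mk4 ℓ′ (suc x) (suc y)
  mk1-copy {x} {y} x≤m 0<y y≤m =
    if-true (inside 1 (m + 1) (suc x) ∧ inside 2 (m + 1) (suc y))
            (cong₂ _∧_ (inside-true 1 (m + 1) (suc x) (s≤s z≤n) (suc≤+1 m x≤m))
                       (inside-true 2 (m + 1) (suc y) (s≤s 0<y) (suc≤+1 m y≤m)))

  mk1-oldEnd : mk1 (suc ℓ′) 1 1 ≡ av21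
  mk1-oldEnd = if-false ((1 ≡ᵇ m + 2) ∧ (1 ≡ᵇ 1)) (∧-falseˡ _ _ (≡ᵇ-false 1 (m + 2) (<⇒≢ (1<+2 m))))

  mk1-endRowEmpty : ∀ {x} → 0 < x → x ≤ m → mk1 (suc ℓ′) (suc x) 1 ≡ ∅
  mk1-endRowEmpty {suc x} _ x≤m =
    trans (if-false (inside 1 (m + 1) (suc (suc x)) ∧ inside 2 (m + 1) 1) (∧-falseʳ _ _ refl))
          (if-false ((suc (suc x) ≡ᵇ m + 2) ∧ (1 ≡ᵇ 1))
                    (∧-falseˡ _ _ (≡ᵇ-false (suc (suc x)) (m + 2)
                                             (<⇒≢ (<-≤-trans (s≤s (suc≤+1 m x≤m)) (+1<+2 m))))))

  mk1-newEnd : mk1 (suc ℓ′) (suc (suc m)) 1 ≡ ⊖12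
  mk1-newEnd =
    trans (if-false (inside 1 (m + 1) (suc (suc m)) ∧ inside 2 (m + 1) 1) (∧-falseʳ _ _ refl))
          (if-true ((suc (suc m) ≡ᵇ m + 2) ∧ (1 ≡ᵇ 1)) (cong (_∧ true) (≡ᵇ-true _ (m + 2) (2+≡+2 m))))

  mk1-newColumnEmpty : ∀ {y} → 0 < y → mk1 (suc ℓ′) (suc (suc m)) (suc y) ≡ ∅
  mk1-newColumnEmpty {suc y} _ =
    trans (if-false (inside 1 (m + 1) (suc (suc m)) ∧ inside 2 (m + 1) (suc (suc y)))
                    (∧-falseˡ _ _ (inside-above 1 (m + 1) (suc (suc m)) (+1<2+ m))))
          (if-false ((suc (suc m) ≡ᵇ m + 2) ∧ (suc (suc y) ≡ᵇ 1)) (∧-falseʳ _ _ refl))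

-- The entries of M^k are given with 1-based indices, layouts use 0-based ones.
zeroBased : (ℕ → ℕ → Label) → ℕ → ℕ → Label
zeroBased f x y = f (suc x) (suc y)

mk1-layout : ∀ ℓ → StaircaseLayout (zeroBased (mk1 ℓ)) (suc (2 * ℓ + 2 * ℓ)) (suc (2 * ℓ)) 0
mk2-layout : ∀ ℓ → StaircaseLayout (zeroBased (mk2 ℓ)) (suc (suc (2 * ℓ + 2 * ℓ)))
                                  (suc (2 * ℓ)) (suc (2 * ℓ))
mk3-layout : ∀ ℓ → StaircaseLayout (zeroBased (mk3 ℓ)) (suc (suc (2 * ℓ) + suc (2 * ℓ))) 0 (suc (2 * ℓ))
mk4-layout : ∀ ℓ → StaircaseLayout (zeroBased (mk4 ℓ)) (suc (suc (suc (2 * ℓ) + suc (2 * ℓ)))) 0 0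

mk1-layout zero = record
  { col          = id
  ; row          = id
  ; col-permutes = permutes-id 2
  ; row-permutes = permutes-id 1
  ; label        = λ { zero → ⊕21 ; (suc _) → ⊖12 }
  ; labelling    = record { start = inj₁ refl ; finish = inj₂ refl ; internal = λ { {suc _} _ (s≤s ()) } }
  ; entry        = λ { {zero} {zero} _ _ → refl ; {suc zero} {zero} _ _ → refl ; {suc (suc _)} (s≤s ()) _ }
  ; endColumn    = refl
  ; endRow       = refl
  }
mk1-layout (suc ℓ) =
  appendColumn (s≤s z≤n) ≤-refl
    (subst (λ k → StaircaseLayout (zeroBased (mk4 ℓ)) k 0 0) k≡m+m (mk4-layout ℓ)) record
  { kept           = λ {x} {y} x≤m y≤m y≢0 →
      trans (cong (λ z → mk1 (suc ℓ) (suc z) (suc y)) (shiftFrom-< (s≤s x≤m)))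
            (mk1-copy ℓ x≤m (n≢0⇒n>0 y≢0) y≤m)
  ; oldEnd         = inj₁ (mk1-oldEnd ℓ)
  ; endRowEmpty    = λ {x} x≤m x≢0 →
      trans (cong (λ z → mk1 (suc ℓ) (suc z) 1) (shiftFrom-< (s≤s x≤m)))
            (mk1-endRowEmpty ℓ (n≢0⇒n>0 x≢0) x≤m)
  ; newEnd         = inj₂ (mk1-newEnd ℓ)
  ; newColumnEmpty = λ y≤m y≢0 → mk1-newColumnEmpty ℓ (n≢0⇒n>0 y≢0)
  }
  where
  n = 2 * ℓ
  k≡m+m : suc (suc (suc n + suc n)) ≡ 2 * suc ℓ + 2 * suc ℓ
  k≡m+m = trans (cong (λ z → suc (suc z)) (sym (+-suc n (suc n)))) (cong (λ N → N + N) (sym (*-suc 2 ℓ)))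
mk2-layout ℓ = appendRow ≤-refl (mk1-layout ℓ) record
  { kept           = λ {x} {y} x≤1+n y≤n x≢1+n →
      trans (cong (λ z → mk2 ℓ (suc x) (suc z)) (shiftFrom-< (s≤s y≤n)))
            (mk2-copy ℓ (≤-pred (≤∧≢⇒< x≤1+n x≢1+n)) y≤n)
  ; oldEnd         = inj₂ (mk2-oldEnd ℓ)
  ; endColumnEmpty = λ {y} y≤n y≢0 →
      trans (cong (λ z → mk2 ℓ (suc (suc (2 * ℓ))) (suc z)) (shiftFrom-< (s≤s y≤n)))
            (mk2-endColumnEmpty ℓ (n≢0⇒n>0 y≢0) y≤n)
  ; newEnd         = inj₁ (mk2-newEnd ℓ)
  ; newRowEmpty    = λ x≤1+n x≢1+n → mk2-newRowEmpty ℓ (≤-pred (≤∧≢⇒< x≤1+n x≢1+n))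
  }
mk3-layout ℓ =
  appendColumn (s≤s z≤n) z≤n
    (subst (λ k → StaircaseLayout (zeroBased (mk2 ℓ)) k (suc n) (suc n)) k≡N+N (mk2-layout ℓ)) record
  { kept           = λ {x} {y} x≤N y≤N y≢N →
      trans (cong (λ z → mk3 ℓ (suc z) (suc y)) (shiftFrom-≥ z≤n))
            (mk3-copy ℓ x≤N (≤-pred (≤∧≢⇒< y≤N y≢N)))
  ; oldEnd         = inj₁ (mk3-oldEnd ℓ)
  ; endRowEmpty    = λ {x} x≤N x≢N →
      trans (cong (λ z → mk3 ℓ (suc z) (suc (suc n))) (shiftFrom-≥ z≤n))
            (mk3-endRowEmpty ℓ (≤-pred (≤∧≢⇒< x≤N x≢N)))
  ; newEnd         = inj₂ (mk3-newEnd ℓ)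
  ; newColumnEmpty = λ y≤N y≢N → mk3-newColumnEmpty ℓ (≤-pred (≤∧≢⇒< y≤N y≢N))
  }
  where
  n = 2 * ℓ
  k≡N+N : suc (suc (n + n)) ≡ suc n + suc n
  k≡N+N = cong suc (sym (+-suc n n))
mk4-layout ℓ = appendRow z≤n (mk3-layout ℓ) record
  { kept           = λ {x} {y} x≤ y≤ x≢0 →
      trans (cong (λ z → mk4 ℓ (suc x) (suc z)) (shiftFrom-≥ z≤n)) (mk4-copy ℓ (n≢0⇒n>0 x≢0) x≤ y≤)
  ; oldEnd         = inj₂ (mk4-oldEnd ℓ)
  ; endColumnEmpty = λ {y} y≤ y≢N →
      trans (cong (λ z → mk4 ℓ 1 (suc z)) (shiftFrom-≥ z≤n))
            (mk4-endColumnEmpty ℓ (≤-pred (≤∧≢⇒< y≤ y≢N)))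
  ; newEnd         = inj₁ (mk4-newEnd ℓ)
  ; newRowEmpty    = λ _ x≢0 → mk4-newRowEmpty ℓ (n≢0⇒n>0 x≢0)
  }

-- 4ℓ + r, written so that its parity and halves are visible
kOf : ℕ → Residue → ℕ
kOf ℓ r1 = suc (2 * ℓ + 2 * ℓ)
kOf ℓ r2 = suc (suc (2 * ℓ + 2 * ℓ))
kOf ℓ r3 = suc (suc (2 * ℓ) + suc (2 * ℓ))
kOf ℓ r4 = suc (suc (suc (2 * ℓ) + suc (2 * ℓ)))

kOf-suc : ∀ ℓ r → kOf (suc ℓ) r ≡ suc (suc (suc (suc (kOf ℓ r))))
kOf-suc ℓ r1 = lemma ℓ
  where
  lemma : ∀ x → suc (2 * suc x + 2 * suc x)
              ≡ suc (suc (suc (suc (suc (2 * x + 2 * x)))))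
  lemma = solve-∀
kOf-suc ℓ r2 = lemma ℓ
  where
  lemma : ∀ x → suc (suc (2 * suc x + 2 * suc x))
              ≡ suc (suc (suc (suc (suc (suc (2 * x + 2 * x))))))
  lemma = solve-∀
kOf-suc ℓ r3 = lemma ℓ
  where
  lemma : ∀ x → suc (suc (2 * suc x) + suc (2 * suc x))
              ≡ suc (suc (suc (suc (suc (suc (2 * x) + suc (2 * x))))))
  lemma = solve-∀
kOf-suc ℓ r4 = lemma ℓ
  where
  lemma : ∀ x → suc (suc (suc (2 * suc x) + suc (2 * suc x)))
              ≡ suc (suc (suc (suc (suc (suc (suc (2 * x) + suc (2 * x)))))))
  lemma = solve-∀

kOf-decomp : ∀ k → 1 ≤ k → kOf (proj₁ (decomp k)) (proj₂ (decomp k)) ≡ k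
kOf-decomp (suc zero)                      _ = refl
kOf-decomp (suc (suc zero))                _ = refl
kOf-decomp (suc (suc (suc zero)))          _ = refl
kOf-decomp (suc (suc (suc (suc zero))))    _ = refl
kOf-decomp (suc (suc (suc (suc (suc k))))) _ with decomp (suc k) | kOf-decomp (suc k) (s≤s z≤n)
... | ℓ , r | eq = trans (kOf-suc ℓ r) (cong (λ k → suc (suc (suc (suc k)))) eq)

layoutOf : ∀ ℓ r → Σ ℕ λ x₀ → Σ ℕ λ y₀ → StaircaseLayout (zeroBased (entR ℓ r)) (kOf ℓ r) x₀ y₀
layoutOf ℓ r1 = _ , _ , mk1-layout ℓ
layoutOf ℓ r2 = _ , _ , mk2-layout ℓ
layoutOf ℓ r3 = _ , _ , mk3-layout ℓ
layoutOf ℓ r4 = _ , _ , mk4-layout ℓ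

colsR-kOf : ∀ ℓ r → colsR ℓ r ≡ suc ⌈ kOf ℓ r /2⌉
colsR-kOf ℓ r1 = trans (+-comm (2 * ℓ) 2) (cong (λ z → suc (suc z)) (n≡⌊n+n/2⌋ (2 * ℓ)))
colsR-kOf ℓ r2 = trans (+-comm (2 * ℓ) 2) (cong (λ z → suc (suc z)) (n≡⌈n+n/2⌉ (2 * ℓ)))
colsR-kOf ℓ r3 = trans (+-comm (2 * ℓ) 3) (cong (λ z → suc (suc z)) (n≡⌊n+n/2⌋ (suc (2 * ℓ))))
colsR-kOf ℓ r4 = trans (+-comm (2 * ℓ) 3) (cong (λ z → suc (suc z)) (n≡⌈n+n/2⌉ (suc (2 * ℓ))))

rowsR-kOf : ∀ ℓ r → rowsR ℓ r ≡ suc ⌊ kOf ℓ r /2⌋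
rowsR-kOf ℓ r1 = trans (+-comm (2 * ℓ) 1) (cong suc (n≡⌈n+n/2⌉ (2 * ℓ)))
rowsR-kOf ℓ r2 = trans (+-comm (2 * ℓ) 2) (cong (λ z → suc (suc z)) (n≡⌊n+n/2⌋ (2 * ℓ)))
rowsR-kOf ℓ r3 = trans (+-comm (2 * ℓ) 2) (cong suc (n≡⌈n+n/2⌉ (suc (2 * ℓ))))
rowsR-kOf ℓ r4 = trans (+-comm (2 * ℓ) 3) (cong (λ z → suc (suc z)) (n≡⌊n+n/2⌋ (suc (2 * ℓ))))

Mk-permutedStaircase : ∀ k → 1 ≤ k → PermutedStaircase (Mk k) k
Mk-permutedStaircase k 1≤k = subst (PermutedStaircase (Mk k)) (kOf-decomp k 1≤k)
  (layout⇒permutedStaircase (proj₂ (proj₂ (layoutOf ℓ r))) (colsR-kOf ℓ r) (rowsR-kOf ℓ r))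
  where
  ℓ = proj₁ (decomp k)
  r = proj₂ (decomp k)

theorem15 : (k : ℕ) → 1 ≤ k →
    ∀ {m n} (M : Matrix m n) →
    NoEmptyLines M →
    AtMostTwoPerLine M →
    LabelledPath M k →
    GridEquivalent M (Mk k)
theorem15 k 1≤k M noEmptyLines atMostTwo labelled
  with labelledPath-permutedStaircase 1≤k noEmptyLines atMostTwo labelled
... | inj₁ S  = permutedStaircases-equivalent S (Mk-permutedStaircase k 1≤k)
... | inj₂ Sᵀ = let (f , f[Mᵀ]≡Mk) = permutedStaircases-equivalent Sᵀ (Mk-permutedStaircase k 1≤k)
                in f ∘g ginverse , f[Mᵀ]≡Mk
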